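{- Write $f(k,m,n)=f_{\text{1--2--1'}}(k,m,n)$. Then: (i) $f(0,m,n)=\binom{n-1}{m-1}$ for $n\ge1$ and $1\le m\le n$; (ii) $f(1,m,n)=\binom{n-2}{m-1}$ for $n\ge3$ and $1\le m\le n-1$; (iii) $f(2,m,n)=2\binom{n-2}{m-1}$ for $n\ge4$ and $1\le m\le n-1$.
   Context: The standard cycle form of $\pi\in\mathcal S_n$ writes each cycle starting with its smallest element, cycles listed in decreasing order of smallest elements; $\Psi(\pi)$ is the word obtained by deleting the parentheses. A cyclic occurrence of the partially ordered pattern 1--2--1' in $\pi$ is a triple of indices $i<j<k$ with $w_j>w_i$ and $w_j>w_k$, where $w=\Psi(\pi)$ (no condition relating $w_i$ and $w_k$); equivalently an occurrence of 1--3--2 or of 2--3--1. $f_{\text{1--2--1'}}(k,m,n)$ is the number of $\pi\in\mathcal S_n$ with $m$ cycles and exactly $k$ cyclic occurrences of 1--2--1'. -}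

module Defs where

open import Data.Nat using (ℕ; zero; suc; _≟_)
open import Data.Fin using (Fin; _<_; _≤_; _<?_; _≤?_)
open import Data.Fin.Properties using () renaming (_≟_ to _≟F_)
open import Data.Vec using (Vec; []; _∷_; lookup; toList)
open import Data.List using (List; []; _∷_; _++_; map; concat; length; filter; allFin; reverse; cartesianProduct; concatMap)
open import Data.List.Relation.Unary.All using (All; all?)
open import Data.Product using (_×_; _,_)
open import Relation.Nullary using (Dec; does)
open import Relation.Nullary.Decidable using (_×-dec_)
open import Data.Bool using (if_then_else_)
open import Relation.Binary.PropositionalEquality using (_≡_)
import Data.List.Relation.Unary.Unique.DecPropositional as UP

-- Permutations of [n] = {0,…,n-1} (represented by Fin n) are encoded by
-- their one-line notation: a vector v of length n with distinct entries,
-- π(i) = lookup v i.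

allVecs : (n l : ℕ) → List (Vec (Fin n) l)
allVecs n zero = [] ∷ []
allVecs n (suc l) =
  concatMap (λ x → map (x ∷_) (allVecs n l)) (allFin n)

IsPerm : ∀ {n} → Vec (Fin n) n → Set
IsPerm {n} v = UP.Unique (_≟F_ {n}) (toList v)

isPerm? : ∀ {n} (v : Vec (Fin n) n) → Dec (IsPerm v)
isPerm? {n} v = UP.unique? (_≟F_ {n}) (toList v)

orbit : ∀ {n} → ℕ → (Fin n → Fin n) → Fin n → Fin n → List (Fin n)
orbit zero    π s x = []
orbit (suc f) π s x =
  x ∷ (if does (π x ≟F s) then [] else orbit f π s (π x))

cycleOf : ∀ {n} → (Fin n → Fin n) → Fin n → List (Fin n)
cycleOf {n} π i = orbit n π i i

IsCycleMin : ∀ {n} → (Fin n → Fin n) → Fin n → Set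
IsCycleMin π i = All (λ j → i ≤ j) (cycleOf π i)

isCycleMin? : ∀ {n} (π : Fin n → Fin n) (i : Fin n) → Dec (IsCycleMin π i)
isCycleMin? π i = all? (λ j → i ≤? j) (cycleOf π i)

cycleMins : ∀ {n} → (Fin n → Fin n) → List (Fin n)
cycleMins {n} π = reverse (filter (isCycleMin? π) (allFin n))

numCycles : ∀ {n} → Vec (Fin n) n → ℕ
numCycles v = length (cycleMins (lookup v))

-- Ψ(π): the standard cycle form (each cycle starting with its smallest
-- element, cycles in decreasing order of smallest elements) with the
-- parentheses deleted.
Ψ : ∀ {n} → Vec (Fin n) n → List (Fin n)
Ψ v = concatMap (cycleOf (lookup v)) (cycleMins (lookup v))

Occ121' : ∀ {n} (w : List (Fin n)) → Fin (length w) × Fin (length w) × Fin (length w) → Set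
Occ121' w (i , j , k) =
  i < j × j < k × Data.List.lookup w i < Data.List.lookup w j × Data.List.lookup w k < Data.List.lookup w j

occ121'? : ∀ {n} (w : List (Fin n)) t → Dec (Occ121' w t)
occ121'? w (i , j , k) =
  (i <? j) ×-dec ((j <? k) ×-dec ((Data.List.lookup w i <? Data.List.lookup w j) ×-dec (Data.List.lookup w k <? Data.List.lookup w j)))

triples : (l : ℕ) → List (Fin l × Fin l × Fin l)
triples l = cartesianProduct (allFin l) (cartesianProduct (allFin l) (allFin l))

numOcc121' : ∀ {n} → List (Fin n) → ℕ
numOcc121' w = length (filter (occ121'? w) (triples (length w)))

cyclicOcc121' : ∀ {n} → Vec (Fin n) n → ℕ
cyclicOcc121' v = numOcc121' (Ψ v)

Counted : (k m n : ℕ) → Vec (Fin n) n → Set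
Counted k m n v = IsPerm v × numCycles v ≡ m × cyclicOcc121' v ≡ k

counted? : ∀ k m n (v : Vec (Fin n) n) → Dec (Counted k m n v)
counted? k m n v = isPerm? v ×-dec ((numCycles v ≟ m) ×-dec (cyclicOcc121' v ≟ k))

f121' : (k m n : ℕ) → ℕ
f121' k m n = length (filter (counted? k m n) (allVecs n n))

-- Deleting the largest letter n from π ∈ S_n leaves a permutation π' ∈ S_(n-1). If n was a fixed
-- point, its cycle comes first in the standard cycle form, so Ψ(π) is n followed by Ψ(π'); π' has one
-- cycle fewer and, n being the largest letter, the same occurrences. Otherwise n sits right after some
-- letter a of Ψ(π'), with the same number of cycles; this creates no occurrence when a is the last
-- letter of Ψ(π') and at least max(1, n - 2) occurrences (n as the middle letter) otherwise. So for
-- k = 0 or k ≤ n - 3 we get f(k,m,n) = f(k,m-1,n-1) + f(k,m,n-1), Pascal's rule, and the three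
-- binomial formulas follow from their values at n = 1, 3, 4, which are checked by computation.

module Submission where

open import Defs
open import Data.Nat using (ℕ; zero; suc; _+_; _*_; _∸_; _≤_; _<_; z≤n; s≤s; _≟_; NonZero)
open import Data.Nat.Properties
  using (≤-refl; ≤-trans; ≤-reflexive; ≤-antisym; <-irrefl; <⇒≱; +-comm; +-suc; +-identityʳ; +-mono-≤; +-monoʳ-≤;
         m≤m+n; m≤n+m; m≤m*n; *-identityˡ; *-distribˡ-+; suc-injective; 1+n≢0; m≤n⇒∃[o]m+o≡n; +-0-monoid; module ≤-Reasoning)
open import Data.Nat.Combinatorics using (_C_; nCk+nC[k+1]≡[n+1]C[k+1])
open import Algebra.Properties.Monoid.Sum +-0-monoid using (sum-syntax; sum-cong-≗; sum-replicate-zero)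
open import Data.Bool using (Bool; true; false; if_then_else_; _∧_)
open import Data.Bool.Properties using (∧-zeroʳ)
open import Data.Empty using (⊥; ⊥-elim)
open import Data.Fin using (Fin; zero; suc; toℕ; inject₁; fromℕ; punchOut)
  renaming (_<_ to _<ᶠ_; _≤_ to _≤ᶠ_; _<?_ to _<ᶠ?_)
open import Data.Fin.Properties
  using (inject₁-injective; fromℕ≢inject₁; toℕ-inject₁; toℕ-fromℕ; inject₁ℕ<; ≤fromℕ; punchOut-injective; any?;
         injective⇒≤; nonZeroIndex)
  renaming (_≟_ to _≟ᶠ_; <-asym to <ᶠ-asym; ≤-refl to ≤ᶠ-refl)
open import Data.Fin.Relation.Unary.Top using (View; view; ‵fromℕ; ‵inject₁; view-fromℕ; view-inject₁)
open import Data.List using (List; []; _∷_; _++_; map; length; filter; allFin; concatMap; reverse; cartesianProduct; cartesianProductWith)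
import Data.List as List
open import Data.List.Properties
  using (length-++; length-map; length-reverse; length-filter; length-tabulate; filter-++; filter-≐; filter-accept; filter-reject;
         filter-none; reverse-++; reverse-map; map-tabulate; map-++; concatMap-cong; concatMap-map; map-concatMap; concatMap-++; ++-assoc)
open import Data.List.Membership.Propositional using (_∈_; _∉_; find)
open import Data.List.Membership.Propositional.Properties
  using (∈-∃++; ∈-filter⁺; ∈-filter⁻; ∈-++⁺ˡ; ∈-++⁺ʳ; ∈-map⁺; ∈-map⁻; ∈-allFin; ∈-cartesianProductWith⁺; ∈-concatMap⁺; ∈-concatMap⁻)
open import Data.List.Relation.Unary.Any using (here; there)
import Data.List.Relation.Unary.Any as Any
open import Data.List.Relation.Unary.All using (All; []; _∷_; universal)
import Data.List.Relation.Unary.All as All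
import Data.List.Relation.Unary.All.Properties as All
open import Data.List.Relation.Unary.All.Properties using (¬Any⇒All¬)
open import Data.List.Relation.Unary.AllPairs using ([]; _∷_)
open import Data.List.Relation.Unary.Unique.Propositional using (Unique)
open import Data.List.Relation.Unary.Unique.Propositional.Properties
  using (filter⁺; ++⁺; map⁺; allFin⁺; tabulate⁺; cartesianProductWith⁺)
open import Data.Vec using (Vec; []; _∷_; lookup; tabulate; toList)
import Data.Vec.Properties as Vec
open import Data.Vec.Properties using (lookup∘tabulate; tabulate∘lookup; tabulate-cong)
open import Data.Vec.Membership.Propositional.Properties using (∈-toList⁺; ∈-lookup)
open import Data.Product using (_×_; _,_; proj₁; proj₂; ∃)
open import Data.Sum using (_⊎_; inj₁; inj₂; [_,_]′)
import Data.Sum as Sum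
open import Function.Base using (_∘_)
open import Function.Definitions using (Injective)
open import Level using (0ℓ)
open import Relation.Nullary using (Dec; does; ¬_; yes; no)
open import Relation.Nullary.Decidable using (dec-true; dec-false; _×-dec_)
open import Relation.Unary using (Pred; Decidable; _⟨⊎⟩_)
open import Relation.Unary.Properties using (_⊎?_)
open import Relation.Binary.PropositionalEquality
  using (_≡_; _≢_; refl; sym; trans; cong; cong₂; subst; subst₂; _≗_; ≢-sym; module ≡-Reasoning)

module _ {A : Set} where

  ∈-++-remove : ∀ {y a : A} us vs → y ∈ us ++ a ∷ vs → y ≢ a → y ∈ us ++ vs
  ∈-++-remove []       vs (here y≡a) y≢a = ⊥-elim (y≢a y≡a)
  ∈-++-remove []       vs (there p)  _   = p
  ∈-++-remove (u ∷ us) vs (here y≡u) _   = here y≡u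
  ∈-++-remove (u ∷ us) vs (there p)  y≢a = there (∈-++-remove us vs p y≢a)

  length-∷-middle : ∀ (us vs : List A) a → length (us ++ a ∷ vs) ≡ suc (length (us ++ vs))
  length-∷-middle us vs a = begin
    length (us ++ a ∷ vs)        ≡⟨ length-++ us ⟩
    length us + suc (length vs)  ≡⟨ +-suc (length us) (length vs) ⟩
    suc (length us + length vs)  ≡⟨ cong suc (length-++ us) ⟨
    suc (length (us ++ vs))      ∎
    where open ≡-Reasoning

module _ {A B : Set} where

  length-≤-injection : (F : A → B) (xs : List A) (ys : List B) → Unique xs →
    (∀ {x} → x ∈ xs → F x ∈ ys) → (∀ {x y} → x ∈ xs → y ∈ xs → F x ≡ F y → x ≡ y) →
    length xs ≤ length ys
  length-≤-injection F []       ys _          _     _   = z≤n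
  length-≤-injection F (x ∷ xs) ys (x∉ ∷ uxs) maps inj with us , vs , refl ← ∈-∃++ (maps (here refl)) =
    ≤-trans (s≤s (length-≤-injection F xs (us ++ vs) uxs maps′ inj′))
            (≤-reflexive (sym (length-∷-middle us vs (F x))))
    where
    maps′ : ∀ {z} → z ∈ xs → F z ∈ us ++ vs
    maps′ z∈ = ∈-++-remove us vs (maps (there z∈)) (λ e → All.lookup x∉ z∈ (inj (here refl) (there z∈) (sym e)))
    inj′ : ∀ {a b} → a ∈ xs → b ∈ xs → F a ≡ F b → a ≡ b
    inj′ p q = inj (there p) (there q)

  module _ {P : Pred A 0ℓ} {Q : Pred B 0ℓ} (P? : Decidable P) (Q? : Decidable Q) where

    length-filter-≤ : (xs : List A) (ys : List B) → Unique xs → (∀ b → b ∈ ys) →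
      (F : A → B) (G : B → A) → (∀ {a} → P a → Q (F a)) → (∀ {a} → P a → G (F a) ≡ a) →
      length (filter P? xs) ≤ length (filter Q? ys)
    length-filter-≤ xs ys uxs ys-complete F G PQ GF =
      length-≤-injection F (filter P? xs) (filter Q? ys) (filter⁺ P? uxs)
        (λ x∈ → ∈-filter⁺ Q? (ys-complete _) (PQ (proj₂ (∈-filter⁻ P? {xs = xs} x∈))))
        (λ x∈ y∈ Fx≡Fy → trans (sym (GF (proj₂ (∈-filter⁻ P? {xs = xs} x∈))))
                          (trans (cong G Fx≡Fy) (GF (proj₂ (∈-filter⁻ P? {xs = xs} y∈)))))

module _ {A B : Set} {P : Pred A 0ℓ} {Q : Pred B 0ℓ} (P? : Decidable P) (Q? : Decidable Q) where

  length-filter-bijection : (xs : List A) (ys : List B) → Unique xs → Unique ys →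
    (∀ a → a ∈ xs) → (∀ b → b ∈ ys) →
    (F : A → B) (G : B → A) → (∀ {a} → P a → Q (F a)) → (∀ {b} → Q b → P (G b)) →
    (∀ {a} → P a → G (F a) ≡ a) → (∀ {b} → Q b → F (G b) ≡ b) →
    length (filter P? xs) ≡ length (filter Q? ys)
  length-filter-bijection xs ys uxs uys xs-complete ys-complete F G PQ QP GF FG =
    ≤-antisym (length-filter-≤ P? Q? xs ys uxs ys-complete F G PQ GF)
              (length-filter-≤ Q? P? ys xs uys xs-complete G F QP FG)

concatMap-map≡cartesianProductWith : ∀ {A B C : Set} (f : A → B → C) xs ys →
  concatMap (λ x → map (f x) ys) xs ≡ cartesianProductWith f xs ys
concatMap-map≡cartesianProductWith f []       ys = refl
concatMap-map≡cartesianProductWith f (x ∷ xs) ys = cong (map (f x) ys ++_) (concatMap-map≡cartesianProductWith f xs ys)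

allVecs-cartesian : ∀ n l → allVecs n (suc l) ≡ cartesianProductWith _∷_ (allFin n) (allVecs n l)
allVecs-cartesian n l = concatMap-map≡cartesianProductWith _∷_ (allFin n) (allVecs n l)

allVecs-complete : ∀ n l (v : Vec (Fin n) l) → v ∈ allVecs n l
allVecs-complete n zero    []      = here refl
allVecs-complete n (suc l) (x ∷ v) = subst (_ ∈_) (sym (allVecs-cartesian n l))
  (∈-cartesianProductWith⁺ _∷_ (∈-allFin x) (allVecs-complete n l v))

allVecs-unique : ∀ n l → Unique (allVecs n l)
allVecs-unique n zero    = [] ∷ []
allVecs-unique n (suc l) = subst Unique (sym (allVecs-cartesian n l))
  (cartesianProductWith⁺ _∷_ Vec.∷-injective (allFin⁺ n) (allVecs-unique n l))

module _ {A B : Set} where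

  enum⊎ : List A → List B → List (A ⊎ B)
  enum⊎ xs ys = map inj₁ xs ++ map inj₂ ys

  enum⊎-unique : ∀ {xs ys} → Unique xs → Unique ys → Unique (enum⊎ xs ys)
  enum⊎-unique uxs uys = ++⁺ (map⁺ (λ { refl → refl }) uxs) (map⁺ (λ { refl → refl }) uys) disjoint
    where
    disjoint : ∀ {v xs ys} → v ∈ map inj₁ xs × v ∈ map inj₂ ys → ⊥
    disjoint (p , q) with ∈-map⁻ inj₁ p | ∈-map⁻ inj₂ q
    ... | _ , _ , refl | _ , _ , ()

  enum⊎-complete : ∀ {xs ys} → (∀ a → a ∈ xs) → (∀ b → b ∈ ys) → ∀ c → c ∈ enum⊎ xs ys
  enum⊎-complete {xs} xs-complete ys-complete (inj₁ a) = ∈-++⁺ˡ (∈-map⁺ inj₁ (xs-complete a))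
  enum⊎-complete {xs} xs-complete ys-complete (inj₂ b) = ∈-++⁺ʳ (map inj₁ xs) (∈-map⁺ inj₂ (ys-complete b))

  length-filter-enum⊎ : ∀ {P : Pred A 0ℓ} {Q : Pred B 0ℓ} (P? : Decidable P) (Q? : Decidable Q) xs ys →
    length (filter (P? ⊎? Q?) (enum⊎ xs ys)) ≡ length (filter P? xs) + length (filter Q? ys)
  length-filter-enum⊎ P? Q? []       []       = refl
  length-filter-enum⊎ P? Q? []       (y ∷ ys) with does (Q? y)
  ... | true  = cong suc (length-filter-enum⊎ P? Q? [] ys)
  ... | false = length-filter-enum⊎ P? Q? [] ys
  length-filter-enum⊎ P? Q? (x ∷ xs) ys       with does (P? x)
  ... | true  = cong suc (length-filter-enum⊎ P? Q? xs ys)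
  ... | false = length-filter-enum⊎ P? Q? xs ys

indicator : Bool → ℕ
indicator b = if b then 1 else 0

module _ {A : Set} {P : Pred A 0ℓ} (P? : Decidable P) where

  length-filter-tabulate : ∀ {L} (g : Fin L → A) →
    length (filter P? (List.tabulate g)) ≡ ∑[ i < L ] indicator (does (P? (g i)))
  length-filter-tabulate {zero}  g = refl
  length-filter-tabulate {suc L} g with does (P? (g zero))
  ... | true  = cong suc (length-filter-tabulate (g ∘ suc))
  ... | false = length-filter-tabulate (g ∘ suc)

  length-filter-map : ∀ {B : Set} (g : B → A) xs → length (filter P? (map g xs)) ≡ length (filter (P? ∘ g) xs)
  length-filter-map g []       = refl
  length-filter-map g (x ∷ xs) with does (P? (g x))
  ... | true  = cong suc (length-filter-map g xs)
  ... | false = length-filter-map g xs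

module _ {A B : Set} {P : Pred (A × B) 0ℓ} (P? : Decidable P) where

  length-filter-cartesianProduct : ∀ {L} (g : Fin L → A) ys →
    length (filter P? (cartesianProduct (List.tabulate g) ys)) ≡ ∑[ i < L ] length (filter (λ y → P? (g i , y)) ys)
  length-filter-cartesianProduct {zero}  g ys = refl
  length-filter-cartesianProduct {suc L} g ys = begin
    length (filter P? (map (g zero ,_) ys ++ cartesianProduct (List.tabulate (g ∘ suc)) ys))
      ≡⟨ cong length (filter-++ P? (map (g zero ,_) ys) _) ⟩
    length (filter P? (map (g zero ,_) ys) ++ filter P? (cartesianProduct (List.tabulate (g ∘ suc)) ys))
      ≡⟨ length-++ (filter P? (map (g zero ,_) ys)) ⟩
    length (filter P? (map (g zero ,_) ys)) + length (filter P? (cartesianProduct (List.tabulate (g ∘ suc)) ys))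
      ≡⟨ cong₂ _+_ (length-filter-map P? (g zero ,_) ys) (length-filter-cartesianProduct (g ∘ suc) ys) ⟩
    ∑[ i < suc L ] length (filter (λ y → P? (g i , y)) ys) ∎
    where open ≡-Reasoning

module _ {n : ℕ} where

  countBelow : Fin n → List (Fin n) → ℕ
  countBelow y []      = 0
  countBelow y (z ∷ w) = indicator (does (z <ᶠ? y)) + countBelow y w

  -- peaksAbove x w counts the occurrences that x would start in front of w: pairs j < k with x < w_j > w_k.
  peaksAbove : Fin n → List (Fin n) → ℕ
  peaksAbove x []      = 0
  peaksAbove x (y ∷ w) = (if does (x <ᶠ? y) then countBelow y w else 0) + peaksAbove x w

  occ121' : List (Fin n) → ℕ
  occ121' []      = 0
  occ121' (x ∷ w) = peaksAbove x w + occ121' w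

  private
    isOcc : (w : List (Fin n)) → Fin (length w) → Fin (length w) → Fin (length w) → Bool
    isOcc w i j k = does (occ121'? w (i , j , k))

    tripleSum : List (Fin n) → ℕ
    tripleSum w = ∑[ i < length w ] ∑[ j < length w ] ∑[ k < length w ] indicator (isOcc w i j k)

    numOcc121'≡tripleSum : ∀ w → numOcc121' w ≡ tripleSum w
    numOcc121'≡tripleSum w = begin
      numOcc121' w
        ≡⟨ length-filter-cartesianProduct (occ121'? w) (λ i → i) _ ⟩
      ∑[ i < L ] length (filter (λ jk → occ121'? w (i , jk)) (cartesianProduct (allFin L) (allFin L)))
        ≡⟨ sum-cong-≗ (λ i → length-filter-cartesianProduct (λ jk → occ121'? w (i , jk)) (λ j → j) (allFin L)) ⟩
      ∑[ i < L ] ∑[ j < L ] length (filter (λ k → occ121'? w (i , j , k)) (allFin L))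
        ≡⟨ sum-cong-≗ (λ i → sum-cong-≗ (λ j → length-filter-tabulate (λ k → occ121'? w (i , j , k)) (λ k → k))) ⟩
      tripleSum w ∎
      where
      open ≡-Reasoning
      L : ℕ
      L = length w

    firstRowSum : Fin n → List (Fin n) → ℕ
    firstRowSum x w = ∑[ j < length w ] ∑[ k < length w ]
      indicator (does (j <ᶠ? k) ∧ (does (x <ᶠ? List.lookup w j) ∧ does (List.lookup w k <ᶠ? List.lookup w j)))

    -- Row i = 0 counts the occurrences starting at x; in the rows i > 0 the entries with j = 0 or
    -- k = 0 vanish since they violate i < j < k.
    tripleSum-∷ : ∀ x w → tripleSum (x ∷ w) ≡ firstRowSum x w + tripleSum w
    tripleSum-∷ x w = cong₂ _+_ firstRow (sum-cong-≗ laterRow)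
      where
      L : ℕ
      L = length w
      zeros : ∑[ k < suc L ] 0 ≡ 0
      zeros = sum-replicate-zero (suc L)
      firstRow : ∑[ j < suc L ] ∑[ k < suc L ] indicator (isOcc (x ∷ w) zero j k) ≡ firstRowSum x w
      firstRow = cong (_+ firstRowSum x w) zeros
      laterRow : ∀ i → ∑[ j < suc L ] ∑[ k < suc L ] indicator (isOcc (x ∷ w) (suc i) j k)
                     ≡ ∑[ j < L ] ∑[ k < L ] indicator (isOcc w i j k)
      laterRow i = cong₂ _+_ zeros (sum-cong-≗ λ j →
        cong (_+ ∑[ k < L ] indicator (isOcc w i j k)) (cong indicator (∧-zeroʳ (does (i <ᶠ? j)))))

    indicator-∧ : ∀ L b (q : Fin L → Bool) → ∑[ k < L ] indicator (b ∧ q k) ≡ (if b then ∑[ k < L ] indicator (q k) else 0)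
    indicator-∧ L true  q = refl
    indicator-∧ L false q = sum-replicate-zero L

    countBelow-∑ : ∀ y w → ∑[ k < length w ] indicator (does (List.lookup w k <ᶠ? y)) ≡ countBelow y w
    countBelow-∑ y []      = refl
    countBelow-∑ y (z ∷ w) = cong (indicator (does (z <ᶠ? y)) +_) (countBelow-∑ y w)

    firstRowSum≡peaksAbove : ∀ x w → firstRowSum x w ≡ peaksAbove x w
    firstRowSum≡peaksAbove x []      = refl
    firstRowSum≡peaksAbove x (y ∷ w) = cong₂ _+_
      (trans (indicator-∧ (length w) (does (x <ᶠ? y)) _)
             (cong (λ c → if does (x <ᶠ? y) then c else 0) (countBelow-∑ y w)))
      (firstRowSum≡peaksAbove x w)

    tripleSum≡occ121' : ∀ w → tripleSum w ≡ occ121' w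
    tripleSum≡occ121' []      = refl
    tripleSum≡occ121' (x ∷ w) = trans (tripleSum-∷ x w) (cong₂ _+_ (firstRowSum≡peaksAbove x w) (tripleSum≡occ121' w))

  numOcc121'≡occ121' : ∀ w → numOcc121' w ≡ occ121' w
  numOcc121'≡occ121' w = trans (numOcc121'≡tripleSum w) (tripleSum≡occ121' w)

  module _ {M : Fin n} where

    countBelow-∷ʳ : ∀ {y} r → y <ᶠ M → countBelow y (r ++ M ∷ []) ≡ countBelow y r
    countBelow-∷ʳ {y} []      y<M = cong (λ b → indicator b + 0) (dec-false (M <ᶠ? y) (<ᶠ-asym y<M))
    countBelow-∷ʳ {y} (z ∷ r) y<M = cong (indicator (does (z <ᶠ? y)) +_) (countBelow-∷ʳ r y<M)

    countBelow-max : ∀ {r} → All (_<ᶠ M) r → countBelow M r ≡ length r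
    countBelow-max {[]}    []           = refl
    countBelow-max {z ∷ r} (z<M ∷ r<M) rewrite dec-true (z <ᶠ? M) z<M = cong suc (countBelow-max r<M)

    peaksAbove-∷ʳ : ∀ x {l} → All (_<ᶠ M) l → peaksAbove x (l ++ M ∷ []) ≡ peaksAbove x l
    peaksAbove-∷ʳ x {[]}    []           = cong (_+ 0) (if-same (does (x <ᶠ? M)))
      where
      if-same : ∀ b → (if b then 0 else 0) ≡ 0
      if-same true  = refl
      if-same false = refl
    peaksAbove-∷ʳ x {y ∷ l} (y<M ∷ l<M) = cong₂ _+_
      (cong (λ c → if does (x <ᶠ? y) then c else 0) (countBelow-∷ʳ l y<M))
      (peaksAbove-∷ʳ x l<M)

    peaksAbove-max : ∀ {l} → All (_<ᶠ M) l → peaksAbove M l ≡ 0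
    peaksAbove-max {[]}    []           = refl
    peaksAbove-max {y ∷ l} (y<M ∷ l<M) rewrite dec-false (M <ᶠ? y) (<ᶠ-asym y<M) = peaksAbove-max l<M

    peaksAbove-++ : ∀ x l w → peaksAbove x w ≤ peaksAbove x (l ++ w)
    peaksAbove-++ x []      w = ≤-refl
    peaksAbove-++ x (y ∷ l) w = ≤-trans (peaksAbove-++ x l w) (m≤n+m _ _)

    occ121'-∷ʳ-max : ∀ {l} → All (_<ᶠ M) l → occ121' (l ++ M ∷ []) ≡ occ121' l
    occ121'-∷ʳ-max {[]}    []           = refl
    occ121'-∷ʳ-max {x ∷ l} (_ ∷ l<M) = cong₂ _+_ (peaksAbove-∷ʳ x l<M) (occ121'-∷ʳ-max l<M)

    occ121'-max-∷ : ∀ {l} → All (_<ᶠ M) l → occ121' (M ∷ l) ≡ occ121' l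
    occ121'-max-∷ l<M = cong (_+ _) (peaksAbove-max l<M)

    -- Each letter of l, the maximum, and each letter of r form an occurrence.
    occ121'-max-middle : ∀ {l r} → All (_<ᶠ M) l → All (_<ᶠ M) r → length l * length r ≤ occ121' (l ++ M ∷ r)
    occ121'-max-middle {[]}    {r} []           r<M = z≤n
    occ121'-max-middle {y ∷ l} {r} (y<M ∷ l<M) r<M = +-mono-≤ peaksAbove-y (occ121'-max-middle l<M r<M)
      where
      peaksAbove-y : length r ≤ peaksAbove y (l ++ M ∷ r)
      peaksAbove-y = begin
        length r                                          ≡⟨ countBelow-max r<M ⟨
        countBelow M r                                    ≡⟨ cong (λ b → if b then countBelow M r else 0) (dec-true (y <ᶠ? M) y<M) ⟨
        (if does (y <ᶠ? M) then countBelow M r else 0)     ≤⟨ m≤m+n _ _ ⟩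
        peaksAbove y (M ∷ r)                              ≤⟨ peaksAbove-++ y l (M ∷ r) ⟩
        peaksAbove y (l ++ M ∷ r)                         ∎
        where open ≤-Reasoning

module _ {n m : ℕ} (g : Fin n → Fin m) (g-<-reflects : ∀ a b → does (g a <ᶠ? g b) ≡ does (a <ᶠ? b)) where

  countBelow-map : ∀ y r → countBelow (g y) (map g r) ≡ countBelow y r
  countBelow-map y []      = refl
  countBelow-map y (z ∷ r) = cong₂ _+_ (cong indicator (g-<-reflects z y)) (countBelow-map y r)

  peaksAbove-map : ∀ x r → peaksAbove (g x) (map g r) ≡ peaksAbove x r
  peaksAbove-map x []      = refl
  peaksAbove-map x (y ∷ r) = cong₂ _+_
    (cong₂ (λ b c → if b then c else 0) (g-<-reflects x y) (countBelow-map y r))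
    (peaksAbove-map x r)

  occ121'-map : ∀ r → occ121' (map g r) ≡ occ121' r
  occ121'-map []      = refl
  occ121'-map (x ∷ r) = cong₂ _+_ (peaksAbove-map x r) (occ121'-map r)

module _ {m : ℕ} where

  top : Fin (suc m)
  top = fromℕ m

  top≢inject₁ : ∀ {y} → top ≢ inject₁ y
  top≢inject₁ = fromℕ≢inject₁

  inject₁≢top : ∀ {y} → inject₁ y ≢ top
  inject₁≢top = ≢-sym top≢inject₁

  inject₁<top : ∀ y → inject₁ y <ᶠ top
  inject₁<top y = subst (toℕ (inject₁ y) <_) (sym (toℕ-fromℕ m)) (inject₁ℕ< y)

  map-inject₁<top : ∀ l → All (_<ᶠ top) (map inject₁ l)
  map-inject₁<top l = All.map⁺ (All.universal inject₁<top l)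

  insertFixed : (Fin m → Fin m) → Fin (suc m) → Fin (suc m)
  insertFixed π x with view x
  ... | ‵fromℕ    = top
  ... | ‵inject₁ y = inject₁ (π y)

  insertAfter : Fin m → (Fin m → Fin m) → Fin (suc m) → Fin (suc m)
  insertAfter a π x with view x
  ... | ‵fromℕ    = inject₁ (π a)
  ... | ‵inject₁ y = if does (y ≟ᶠ a) then top else inject₁ (π y)

  -- Left inverse of inject₁, with the junk value d at top.
  lowerOr : Fin m → Fin (suc m) → Fin m
  lowerOr d x with view x
  ... | ‵fromℕ    = d
  ... | ‵inject₁ y = y

  -- Deletes top from its cycle: the preimage of top is redirected to the image of top.
  removeTop : (Fin (suc m) → Fin (suc m)) → Fin m → Fin m
  removeTop π y = lowerOr y (if does (π (inject₁ y) ≟ᶠ top) then π top else π (inject₁ y))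

  insertFixed-inject₁ : ∀ π y → insertFixed π (inject₁ y) ≡ inject₁ (π y)
  insertFixed-inject₁ π y rewrite view-inject₁ y = refl

  insertFixed-top : ∀ π → insertFixed π top ≡ top
  insertFixed-top π rewrite view-fromℕ m = refl

  insertAfter-anchor : ∀ a π → insertAfter a π (inject₁ a) ≡ top
  insertAfter-anchor a π rewrite view-inject₁ a | dec-true (a ≟ᶠ a) refl = refl

  insertAfter-inject₁ : ∀ a π {y} → y ≢ a → insertAfter a π (inject₁ y) ≡ inject₁ (π y)
  insertAfter-inject₁ a π {y} y≢a rewrite view-inject₁ y | dec-false (y ≟ᶠ a) y≢a = refl

  insertAfter-top : ∀ a π → insertAfter a π top ≡ inject₁ (π a)
  insertAfter-top a π rewrite view-fromℕ m = refl

  lowerOr-inject₁ : ∀ d y → lowerOr d (inject₁ y) ≡ y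
  lowerOr-inject₁ d y rewrite view-inject₁ y = refl

  inject₁-lowerOr : ∀ d x → x ≢ top → inject₁ (lowerOr d x) ≡ x
  inject₁-lowerOr d x x≢top with view x
  ... | ‵fromℕ  = ⊥-elim (x≢top refl)
  ... | ‵inject₁ _ = refl

  module _ (π : Fin (suc m) → Fin (suc m)) (y : Fin m) where

    removeTop-skip : π (inject₁ y) ≢ top → removeTop π y ≡ lowerOr y (π (inject₁ y))
    removeTop-skip πy≢top rewrite dec-false (π (inject₁ y) ≟ᶠ top) πy≢top = refl

    removeTop-bypass : π (inject₁ y) ≡ top → removeTop π y ≡ lowerOr y (π top)
    removeTop-bypass πy≡top rewrite dec-true (π (inject₁ y) ≟ᶠ top) πy≡top = refl

    inject₁-removeTop-skip : π (inject₁ y) ≢ top → inject₁ (removeTop π y) ≡ π (inject₁ y)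
    inject₁-removeTop-skip πy≢top = trans (cong inject₁ (removeTop-skip πy≢top)) (inject₁-lowerOr y _ πy≢top)

    inject₁-removeTop-bypass : Injective _≡_ _≡_ π → π (inject₁ y) ≡ top → inject₁ (removeTop π y) ≡ π top
    inject₁-removeTop-bypass π-inj πy≡top = trans (cong inject₁ (removeTop-bypass πy≡top))
      (inject₁-lowerOr y _ (λ πtop≡top → top≢inject₁ (π-inj (trans πtop≡top (sym πy≡top)))))

  removeTop-cong : ∀ {π σ} → π ≗ σ → removeTop π ≗ removeTop σ
  removeTop-cong {π} {σ} π≗σ y rewrite π≗σ (inject₁ y) | π≗σ top = refl

  insertFixed-cong : ∀ {π σ} → π ≗ σ → insertFixed π ≗ insertFixed σ
  insertFixed-cong π≗σ x with view x
  ... | ‵fromℕ    = refl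
  ... | ‵inject₁ y = cong inject₁ (π≗σ y)

  insertAfter-cong : ∀ a {π σ} → π ≗ σ → insertAfter a π ≗ insertAfter a σ
  insertAfter-cong a π≗σ x with view x
  ... | ‵fromℕ    = cong inject₁ (π≗σ a)
  ... | ‵inject₁ y rewrite π≗σ y = refl

  removeTop-insertFixed : ∀ π → removeTop (insertFixed π) ≗ π
  removeTop-insertFixed π y = begin
    removeTop (insertFixed π) y             ≡⟨ removeTop-skip (insertFixed π) y (inject₁≢top ∘ trans (sym (insertFixed-inject₁ π y))) ⟩
    lowerOr y (insertFixed π (inject₁ y))   ≡⟨ cong (lowerOr y) (insertFixed-inject₁ π y) ⟩
    lowerOr y (inject₁ (π y))               ≡⟨ lowerOr-inject₁ y (π y) ⟩
    π y                                     ∎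
    where open ≡-Reasoning

  removeTop-insertAfter : ∀ a π → removeTop (insertAfter a π) ≗ π
  removeTop-insertAfter a π y with y ≟ᶠ a
  ... | yes refl = begin
    removeTop (insertAfter a π) a           ≡⟨ removeTop-bypass (insertAfter a π) a (insertAfter-anchor a π) ⟩
    lowerOr a (insertAfter a π top)         ≡⟨ cong (lowerOr a) (insertAfter-top a π) ⟩
    lowerOr a (inject₁ (π a))               ≡⟨ lowerOr-inject₁ a (π a) ⟩
    π a                                     ∎
    where open ≡-Reasoning
  ... | no y≢a = begin
    removeTop (insertAfter a π) y           ≡⟨ removeTop-skip (insertAfter a π) y (inject₁≢top ∘ trans (sym (insertAfter-inject₁ a π y≢a))) ⟩
    lowerOr y (insertAfter a π (inject₁ y)) ≡⟨ cong (lowerOr y) (insertAfter-inject₁ a π y≢a) ⟩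
    lowerOr y (inject₁ (π y))               ≡⟨ lowerOr-inject₁ y (π y) ⟩
    π y                                     ∎
    where open ≡-Reasoning

  removeTop-injective : ∀ {π} → Injective _≡_ _≡_ π → Injective _≡_ _≡_ (removeTop π)
  removeTop-injective {π} π-inj {y} {z} e = byCases (π (inject₁ y) ≟ᶠ top) (π (inject₁ z) ≟ᶠ top)
    where
    open ≡-Reasoning
    byCases : Dec (π (inject₁ y) ≡ top) → Dec (π (inject₁ z) ≡ top) → y ≡ z
    byCases (yes πy≡top) (yes πz≡top) = inject₁-injective (π-inj (trans πy≡top (sym πz≡top)))
    byCases (yes πy≡top) (no  πz≢top) = ⊥-elim (top≢inject₁ (π-inj (begin
      π top                      ≡⟨ inject₁-removeTop-bypass π y π-inj πy≡top ⟨
      inject₁ (removeTop π y)    ≡⟨ cong inject₁ e ⟩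
      inject₁ (removeTop π z)    ≡⟨ inject₁-removeTop-skip π z πz≢top ⟩
      π (inject₁ z)              ∎)))
    byCases (no  πy≢top) (yes πz≡top) = ⊥-elim (top≢inject₁ (π-inj (begin
      π top                      ≡⟨ inject₁-removeTop-bypass π z π-inj πz≡top ⟨
      inject₁ (removeTop π z)    ≡⟨ cong inject₁ e ⟨
      inject₁ (removeTop π y)    ≡⟨ inject₁-removeTop-skip π y πy≢top ⟩
      π (inject₁ y)              ∎)))
    byCases (no  πy≢top) (no  πz≢top) = inject₁-injective (π-inj (begin
      π (inject₁ y)              ≡⟨ inject₁-removeTop-skip π y πy≢top ⟨
      inject₁ (removeTop π y)    ≡⟨ cong inject₁ e ⟩
      inject₁ (removeTop π z)    ≡⟨ inject₁-removeTop-skip π z πz≢top ⟩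
      π (inject₁ z)              ∎))

  insertFixed-injective : ∀ {π} → Injective _≡_ _≡_ π → Injective _≡_ _≡_ (insertFixed π)
  insertFixed-injective {π} π-inj {x} {x′} e with view x | view x′
  ... | ‵fromℕ     | ‵fromℕ      = refl
  ... | ‵fromℕ     | ‵inject₁ y′ = ⊥-elim (top≢inject₁ e)
  ... | ‵inject₁ y | ‵fromℕ      = ⊥-elim (inject₁≢top e)
  ... | ‵inject₁ y | ‵inject₁ y′ = cong inject₁ (π-inj (inject₁-injective e))

  private
    insertAfter-image≢image-of-top : ∀ a {π : Fin m → Fin m} → Injective _≡_ _≡_ π → ∀ y →
      (if does (y ≟ᶠ a) then top else inject₁ (π y)) ≢ inject₁ (π a)
    insertAfter-image≢image-of-top a π-inj y e with y ≟ᶠ a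
    ... | yes _   = top≢inject₁ e
    ... | no  y≢a = y≢a (π-inj (inject₁-injective e))

  insertAfter-injective : ∀ a {π} → Injective _≡_ _≡_ π → Injective _≡_ _≡_ (insertAfter a π)
  insertAfter-injective a {π} π-inj {x} {x′} e with view x | view x′
  ... | ‵fromℕ     | ‵fromℕ      = refl
  ... | ‵fromℕ     | ‵inject₁ y′ = ⊥-elim (insertAfter-image≢image-of-top a π-inj y′ (sym e))
  ... | ‵inject₁ y | ‵fromℕ      = ⊥-elim (insertAfter-image≢image-of-top a π-inj y e)
  ... | ‵inject₁ y | ‵inject₁ y′ with y ≟ᶠ a | y′ ≟ᶠ a
  ...   | yes y≡a | yes y′≡a = cong inject₁ (trans y≡a (sym y′≡a))
  ...   | yes _   | no  _    = ⊥-elim (top≢inject₁ e)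
  ...   | no  _   | yes _    = ⊥-elim (inject₁≢top e)
  ...   | no  _   | no  _    = cong inject₁ (π-inj (inject₁-injective e))

  top-∈-image : ∀ {π : Fin (suc m) → Fin (suc m)} → Injective _≡_ _≡_ π → ∃ λ x → π x ≡ top
  top-∈-image {π} π-inj with any? (λ x → π x ≟ᶠ top)
  ... | yes hit = hit
  ... | no  miss = ⊥-elim (<-irrefl refl (injective⇒≤ {f = lowered} lowered-injective))
    where
    lowered : Fin (suc m) → Fin m
    lowered x = punchOut {i = top} (λ e → miss (x , sym e))
    lowered-injective : Injective _≡_ _≡_ lowered
    lowered-injective {x} {y} e = π-inj (punchOut-injective {i = top} (λ e → miss (x , sym e)) (λ e → miss (y , sym e)) e)

  insertTop-cases : ∀ {π} → Injective _≡_ _≡_ π →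
    (π top ≡ top × π ≗ insertFixed (removeTop π)) ⊎ (∃ λ a → π top ≢ top × π ≗ insertAfter a (removeTop π))
  insertTop-cases {π} π-inj with π top ≟ᶠ top
  ... | yes πtop≡top = inj₁ (πtop≡top , λ x → fixedCase (view x))
    where
    fixedCase : ∀ {x} → View x → π x ≡ insertFixed (removeTop π) x
    fixedCase ‵fromℕ = trans πtop≡top (sym (insertFixed-top _))
    fixedCase (‵inject₁ y) = sym (trans (insertFixed-inject₁ _ y)
      (inject₁-removeTop-skip π y (λ e → inject₁≢top (π-inj (trans e (sym πtop≡top))))))
  ... | no πtop≢top with top-∈-image π-inj
  ...   | x , πx≡top with view x
  ...     | ‵fromℕ     = ⊥-elim (πtop≢top πx≡top)
  ...     | ‵inject₁ a = inj₂ (a , πtop≢top , λ x → afterCase (view x))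
    where
    afterCase : ∀ {x} → View x → π x ≡ insertAfter a (removeTop π) x
    afterCase ‵fromℕ = sym (trans (insertAfter-top a _) (inject₁-removeTop-bypass π a π-inj πx≡top))
    afterCase (‵inject₁ y) with y ≟ᶠ a
    ... | yes refl = trans πx≡top (sym (insertAfter-anchor a _))
    ... | no  y≢a  = sym (trans (insertAfter-inject₁ a _ y≢a)
      (inject₁-removeTop-skip π y (λ e → y≢a (inject₁-injective (π-inj (trans e (sym πx≡top)))))))

-- Iterating π from x reaches s within f steps, so that orbit f π s x is not cut off by its fuel.
Reaches : ∀ {n} → ℕ → (Fin n → Fin n) → Fin n → Fin n → Set
Reaches zero    π s x = ⊥
Reaches (suc f) π s x = π x ≡ s ⊎ (π x ≢ s × Reaches f π s (π x))

module _ {n : ℕ} where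

  orbit-stop : ∀ f (π : Fin n → Fin n) {s x} → π x ≡ s → orbit (suc f) π s x ≡ x ∷ []
  orbit-stop f π {s} {x} πx≡s rewrite dec-true (π x ≟ᶠ s) πx≡s = refl

  orbit-step : ∀ f (π : Fin n → Fin n) {s x} → π x ≢ s → orbit (suc f) π s x ≡ x ∷ orbit f π s (π x)
  orbit-step f π {s} {x} πx≢s rewrite dec-false (π x ≟ᶠ s) πx≢s = refl

  orbit-suc : ∀ f {π : Fin n → Fin n} {s x} → Reaches f π s x → orbit (suc f) π s x ≡ orbit f π s x
  orbit-suc (suc f) {π} (inj₁ πx≡s)       = trans (orbit-stop (suc f) π πx≡s) (sym (orbit-stop f π πx≡s))
  orbit-suc (suc f) {π} (inj₂ (πx≢s , r)) =
    trans (orbit-step (suc f) π πx≢s) (trans (cong (_ ∷_) (orbit-suc f r)) (sym (orbit-step f π πx≢s)))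

  orbit-cong : ∀ {π σ : Fin n → Fin n} → π ≗ σ → ∀ f s x → orbit f π s x ≡ orbit f σ s x
  orbit-cong π≗σ zero    s x = refl
  orbit-cong {π} {σ} π≗σ (suc f) s x with π x ≟ᶠ s
  ... | yes πx≡s = sym (orbit-stop f σ (trans (sym (π≗σ x)) πx≡s))
  ... | no  πx≢s = trans (cong (x ∷_) (trans (orbit-cong π≗σ f s (π x)) (cong (orbit f σ s) (π≗σ x))))
                         (sym (orbit-step f σ (πx≢s ∘ trans (π≗σ x))))

  Reaches-cong : ∀ {π σ : Fin n → Fin n} → π ≗ σ → ∀ f {s x} → Reaches f π s x → Reaches f σ s x
  Reaches-cong π≗σ (suc f) {x = x} (inj₁ πx≡s)         = inj₁ (trans (sym (π≗σ x)) πx≡s)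
  Reaches-cong π≗σ (suc f) {s} {x} (inj₂ (πx≢s , r))   =
    inj₂ (πx≢s ∘ trans (π≗σ x) , subst (Reaches f _ s) (π≗σ x) (Reaches-cong π≗σ f r))

  Reaches-suc : ∀ f {π : Fin n → Fin n} {s x} → Reaches f π s x → Reaches (suc f) π s x
  Reaches-suc (suc f) (inj₁ πx≡s)       = inj₁ πx≡s
  Reaches-suc (suc f) (inj₂ (πx≢s , r)) = inj₂ (πx≢s , Reaches-suc f r)

  start∈orbit : ∀ {f} (π : Fin n → Fin n) s x → .{{NonZero f}} → x ∈ orbit f π s x
  start∈orbit {suc f} π s x = here refl

  orbit-unique-tail : ∀ f {π : Fin n → Fin n} {s x} → π x ≢ s → Unique (orbit (suc f) π s x) →
    Unique (orbit f π s (π x)) × x ∉ orbit f π s (π x)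
  orbit-unique-tail f {π} πx≢s u with subst Unique (orbit-step f π πx≢s) u
  ... | x∉ ∷ u′ = u′ , λ x∈ → All.lookup x∉ x∈ refl

module _ {m : ℕ} where

  insertTopAfter : Fin m → List (Fin m) → List (Fin (suc m))
  insertTopAfter a = concatMap (λ y → inject₁ y ∷ (if does (y ≟ᶠ a) then top ∷ [] else []))

  insertTopAfter-anchor : ∀ a l → insertTopAfter a (a ∷ l) ≡ inject₁ a ∷ top ∷ insertTopAfter a l
  insertTopAfter-anchor a l rewrite dec-true (a ≟ᶠ a) refl = refl

  insertTopAfter-skip : ∀ a {y} l → y ≢ a → insertTopAfter a (y ∷ l) ≡ inject₁ y ∷ insertTopAfter a l
  insertTopAfter-skip a {y} l y≢a rewrite dec-false (y ≟ᶠ a) y≢a = refl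

  insertTopAfter-∉ : ∀ a l → a ∉ l → insertTopAfter a l ≡ map inject₁ l
  insertTopAfter-∉ a []      _   = refl
  insertTopAfter-∉ a (y ∷ l) a∉ = trans (insertTopAfter-skip a l (a∉ ∘ here ∘ sym))
                                        (cong (inject₁ y ∷_) (insertTopAfter-∉ a l (a∉ ∘ there)))

  ∈-insertTopAfter⁻ : ∀ a l {z} → z ∈ insertTopAfter a l → z ≡ top ⊎ ∃ λ y → y ∈ l × z ≡ inject₁ y
  ∈-insertTopAfter⁻ a l z∈ with y , y∈ , z∈block ← find (∈-concatMap⁻ _ {xs = l} z∈) = block y∈ (y ≟ᶠ a) z∈block
    where
    block : ∀ {y z} → y ∈ l → (d : Dec (y ≡ a)) → z ∈ inject₁ y ∷ (if does d then top ∷ [] else []) →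
      z ≡ top ⊎ ∃ λ y → y ∈ l × z ≡ inject₁ y
    block y∈ _         (here z≡y)         = inj₂ (_ , y∈ , z≡y)
    block y∈ (yes _)   (there (here z≡top)) = inj₁ z≡top

  top∉map-inject₁ : ∀ {l : List (Fin m)} → top ∉ map inject₁ l
  top∉map-inject₁ top∈ with _ , _ , e ← ∈-map⁻ inject₁ top∈ = top≢inject₁ e

  insertTopAfter-unique : ∀ a {l} → Unique l → Unique (insertTopAfter a l)
  insertTopAfter-unique a {[]}    []         = []
  insertTopAfter-unique a {y ∷ l} (y∉ ∷ ul) = byAnchor (y ≟ᶠ a)
    where
    byAnchor : Dec (y ≡ a) → Unique (insertTopAfter a (y ∷ l))
    byAnchor (yes refl) = subst Unique (sym (trans (insertTopAfter-anchor a l) (cong (λ w → inject₁ a ∷ top ∷ w) (insertTopAfter-∉ a l a∉l))))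
        (¬Any⇒All¬ _ inject₁a∉ ∷ ¬Any⇒All¬ _ top∉map-inject₁ ∷ map⁺ inject₁-injective ul)
      where
      a∉l : a ∉ l
      a∉l a∈ = All.lookup y∉ a∈ refl
      inject₁a∉ : inject₁ a ∉ top ∷ map inject₁ l
      inject₁a∉ (here e)   = inject₁≢top e
      inject₁a∉ (there p) with _ , y∈ , e ← ∈-map⁻ inject₁ p = a∉l (subst (_∈ l) (sym (inject₁-injective e)) y∈)
    byAnchor (no y≢a) = subst Unique (sym (insertTopAfter-skip a l y≢a)) (¬Any⇒All¬ _ inject₁y∉ ∷ insertTopAfter-unique a ul)
      where
      inject₁y∉ : inject₁ y ∉ insertTopAfter a l
      inject₁y∉ p with ∈-insertTopAfter⁻ a l p
      ... | inj₁ e              = inject₁≢top e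
      ... | inj₂ (y′ , y′∈ , e) = All.lookup y∉ y′∈ (inject₁-injective e)

  ∈-insertTopAfter⁺ : ∀ a {l y} → y ∈ l → inject₁ y ∈ insertTopAfter a l
  ∈-insertTopAfter⁺ a y∈ = ∈-concatMap⁺ _ (Any.map (λ { refl → here refl }) y∈)

  top∈insertTopAfter : ∀ a {l} → a ∈ l → top ∈ insertTopAfter a l
  top∈insertTopAfter a a∈ = ∈-concatMap⁺ _ (Any.map (λ { refl → top∈anchor }) a∈)
    where
    top∈anchor : top ∈ inject₁ a ∷ (if does (a ≟ᶠ a) then top ∷ [] else [])
    top∈anchor rewrite dec-true (a ≟ᶠ a) refl = there (here refl)

  insertTopAfter-split : ∀ a U V → a ∉ U → a ∉ V →
    insertTopAfter a (U ++ a ∷ V) ≡ map inject₁ (U ++ a ∷ []) ++ top ∷ map inject₁ V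
  insertTopAfter-split a U V a∉U a∉V = begin
    insertTopAfter a (U ++ a ∷ V)                     ≡⟨ concatMap-++ _ U (a ∷ V) ⟩
    insertTopAfter a U ++ insertTopAfter a (a ∷ V)    ≡⟨ cong₂ _++_ (insertTopAfter-∉ a U a∉U)
                                                           (trans (insertTopAfter-anchor a V) (cong (λ w → inject₁ a ∷ top ∷ w) (insertTopAfter-∉ a V a∉V))) ⟩
    map inject₁ U ++ inject₁ a ∷ top ∷ map inject₁ V  ≡⟨ ++-assoc (map inject₁ U) (inject₁ a ∷ []) _ ⟨
    (map inject₁ U ++ inject₁ a ∷ []) ++ top ∷ map inject₁ V ≡⟨ cong (_++ top ∷ map inject₁ V) (map-++ inject₁ U (a ∷ [])) ⟨
    map inject₁ (U ++ a ∷ []) ++ top ∷ map inject₁ V  ∎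
    where open ≡-Reasoning

  insertTopAfter-concatMap : ∀ {A : Set} a (g : A → List (Fin m)) xs →
    insertTopAfter a (concatMap g xs) ≡ concatMap (insertTopAfter a ∘ g) xs
  insertTopAfter-concatMap a g []       = refl
  insertTopAfter-concatMap a g (x ∷ xs) =
    trans (concatMap-++ _ (g x) (concatMap g xs)) (cong (insertTopAfter a (g x) ++_) (insertTopAfter-concatMap a g xs))

module _ {m : ℕ} (π : Fin m → Fin m) where

  private
    σ : Fin (suc m) → Fin (suc m)
    σ = insertFixed π

  orbit-insertFixed : ∀ f s x → orbit f σ (inject₁ s) (inject₁ x) ≡ map inject₁ (orbit f π s x)
  orbit-insertFixed zero    s x = refl
  orbit-insertFixed (suc f) s x with π x ≟ᶠ s
  ... | yes πx≡s = orbit-stop f σ (trans (insertFixed-inject₁ π x) (cong inject₁ πx≡s))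
  ... | no  πx≢s = begin
    orbit (suc f) σ (inject₁ s) (inject₁ x)           ≡⟨ orbit-step f σ (πx≢s ∘ inject₁-injective ∘ trans (sym (insertFixed-inject₁ π x))) ⟩
    inject₁ x ∷ orbit f σ (inject₁ s) (σ (inject₁ x)) ≡⟨ cong (λ y → inject₁ x ∷ orbit f σ (inject₁ s) y) (insertFixed-inject₁ π x) ⟩
    inject₁ x ∷ orbit f σ (inject₁ s) (inject₁ (π x)) ≡⟨ cong (inject₁ x ∷_) (orbit-insertFixed f s (π x)) ⟩
    map inject₁ (x ∷ orbit f π s (π x))               ∎
    where open ≡-Reasoning

  Reaches-insertFixed : ∀ f {s x} → Reaches f π s x → Reaches f σ (inject₁ s) (inject₁ x)
  Reaches-insertFixed (suc f) {x = x} (inj₁ πx≡s) = inj₁ (trans (insertFixed-inject₁ π x) (cong inject₁ πx≡s))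
  Reaches-insertFixed (suc f) {s} {x} (inj₂ (πx≢s , r)) =
    inj₂ (πx≢s ∘ inject₁-injective ∘ trans (sym (insertFixed-inject₁ π x)) ,
          subst (Reaches f σ (inject₁ s)) (sym (insertFixed-inject₁ π x)) (Reaches-insertFixed f r))

  cycleOrbit-insertFixed : ∀ s → Reaches m π s s →
    orbit (suc m) σ (inject₁ s) (inject₁ s) ≡ map inject₁ (orbit m π s s)
  cycleOrbit-insertFixed s r = trans (orbit-insertFixed (suc m) s s) (cong (map inject₁) (orbit-suc m r))

  cycleOrbit-insertFixed-top : orbit (suc m) σ top top ≡ top ∷ []
  cycleOrbit-insertFixed-top = orbit-stop m σ (insertFixed-top π)

module _ {m : ℕ} (a : Fin m) (π : Fin m → Fin m) where

  private
    σ : Fin (suc m) → Fin (suc m)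
    σ = insertAfter a π

    σ-skip : ∀ {x} → x ≢ a → σ (inject₁ x) ≡ inject₁ (π x)
    σ-skip = insertAfter-inject₁ a π

    σ-anchor : σ (inject₁ a) ≡ top
    σ-anchor = insertAfter-anchor a π

    σ-top : σ top ≡ inject₁ (π a)
    σ-top = insertAfter-top a π

    inject₁-≢ : ∀ {y z : Fin m} {w} → w ≡ inject₁ y → y ≢ z → w ≢ inject₁ z
    inject₁-≢ refl y≢z = y≢z ∘ inject₁-injective

    σ-anchor≢ : ∀ {y} → σ (inject₁ a) ≢ inject₁ y
    σ-anchor≢ e = top≢inject₁ (trans (sym σ-anchor) e)

    a∉-tail : ∀ f {s x} → π x ≢ s → a ∉ orbit (suc f) π s x → a ∉ orbit f π s (π x)
    a∉-tail f πx≢s a∉ = a∉ ∘ subst (a ∈_) (sym (orbit-step f π πx≢s)) ∘ there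

  orbit-insertAfter-∉ : ∀ f {s x} → Reaches f π s x → a ∉ orbit f π s x →
    orbit f σ (inject₁ s) (inject₁ x) ≡ map inject₁ (orbit f π s x)
  orbit-insertAfter-∉ (suc f) {s} {x} (inj₁ πx≡s) a∉ = begin
    orbit (suc f) σ (inject₁ s) (inject₁ x)  ≡⟨ orbit-stop f σ (trans (σ-skip (a∉ ∘ here ∘ sym)) (cong inject₁ πx≡s)) ⟩
    inject₁ x ∷ []                           ≡⟨ cong (map inject₁) (orbit-stop f π πx≡s) ⟨
    map inject₁ (orbit (suc f) π s x)        ∎
    where open ≡-Reasoning
  orbit-insertAfter-∉ (suc f) {s} {x} (inj₂ (πx≢s , r)) a∉ = begin
    orbit (suc f) σ (inject₁ s) (inject₁ x)           ≡⟨ orbit-step f σ (inject₁-≢ σx≡ πx≢s) ⟩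
    inject₁ x ∷ orbit f σ (inject₁ s) (σ (inject₁ x)) ≡⟨ cong (λ y → inject₁ x ∷ orbit f σ (inject₁ s) y) σx≡ ⟩
    inject₁ x ∷ orbit f σ (inject₁ s) (inject₁ (π x)) ≡⟨ cong (inject₁ x ∷_) (orbit-insertAfter-∉ f r (a∉-tail f πx≢s a∉)) ⟩
    map inject₁ (x ∷ orbit f π s (π x))               ≡⟨ cong (map inject₁) (orbit-step f π πx≢s) ⟨
    map inject₁ (orbit (suc f) π s x)                 ∎
    where
    open ≡-Reasoning
    σx≡ : σ (inject₁ x) ≡ inject₁ (π x)
    σx≡ = σ-skip (a∉ ∘ here ∘ sym)

  Reaches-insertAfter-∉ : ∀ f {s x} → Reaches f π s x → a ∉ orbit f π s x → Reaches f σ (inject₁ s) (inject₁ x)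
  Reaches-insertAfter-∉ (suc f) (inj₁ πx≡s) a∉ = inj₁ (trans (σ-skip (a∉ ∘ here ∘ sym)) (cong inject₁ πx≡s))
  Reaches-insertAfter-∉ (suc f) {s} {x} (inj₂ (πx≢s , r)) a∉ = inj₂ (inject₁-≢ σx≡ πx≢s ,
    subst (Reaches f σ (inject₁ s)) (sym σx≡) (Reaches-insertAfter-∉ f r (a∉-tail f πx≢s a∉)))
    where
    σx≡ : σ (inject₁ x) ≡ inject₁ (π x)
    σx≡ = σ-skip (a∉ ∘ here ∘ sym)

  -- From a, σ detours through top and then follows π, which avoids a until the cycle closes.
  orbit-insertAfter-anchor : ∀ f {s} → Reaches (suc f) π s a → Unique (orbit (suc f) π s a) →
    orbit (suc (suc f)) σ (inject₁ s) (inject₁ a) ≡ insertTopAfter a (orbit (suc f) π s a)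
  orbit-insertAfter-anchor f {s} (inj₁ πa≡s) u = begin
    orbit (suc (suc f)) σ (inject₁ s) (inject₁ a)           ≡⟨ orbit-step (suc f) σ σ-anchor≢ ⟩
    inject₁ a ∷ orbit (suc f) σ (inject₁ s) (σ (inject₁ a)) ≡⟨ cong (λ y → inject₁ a ∷ orbit (suc f) σ (inject₁ s) y) σ-anchor ⟩
    inject₁ a ∷ orbit (suc f) σ (inject₁ s) top             ≡⟨ cong (inject₁ a ∷_) (orbit-stop f σ (trans σ-top (cong inject₁ πa≡s))) ⟩
    inject₁ a ∷ top ∷ []                                    ≡⟨ insertTopAfter-anchor a [] ⟨
    insertTopAfter a (a ∷ [])                               ≡⟨ cong (insertTopAfter a) (orbit-stop f π πa≡s) ⟨
    insertTopAfter a (orbit (suc f) π s a)                  ∎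
    where open ≡-Reasoning
  orbit-insertAfter-anchor f {s} (inj₂ (πa≢s , r)) u = begin
    orbit (suc (suc f)) σ (inject₁ s) (inject₁ a)           ≡⟨ orbit-step (suc f) σ σ-anchor≢ ⟩
    inject₁ a ∷ orbit (suc f) σ (inject₁ s) (σ (inject₁ a)) ≡⟨ cong (λ y → inject₁ a ∷ orbit (suc f) σ (inject₁ s) y) σ-anchor ⟩
    inject₁ a ∷ orbit (suc f) σ (inject₁ s) top             ≡⟨ cong (inject₁ a ∷_) (orbit-step f σ (inject₁-≢ σ-top πa≢s)) ⟩
    inject₁ a ∷ top ∷ orbit f σ (inject₁ s) (σ top)         ≡⟨ cong (λ y → inject₁ a ∷ top ∷ orbit f σ (inject₁ s) y) σ-top ⟩
    inject₁ a ∷ top ∷ orbit f σ (inject₁ s) (inject₁ (π a)) ≡⟨ cong (λ w → inject₁ a ∷ top ∷ w) (orbit-insertAfter-∉ f r a∉) ⟩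
    inject₁ a ∷ top ∷ map inject₁ (orbit f π s (π a))       ≡⟨ cong (λ w → inject₁ a ∷ top ∷ w) (insertTopAfter-∉ a (orbit f π s (π a)) a∉) ⟨
    inject₁ a ∷ top ∷ insertTopAfter a (orbit f π s (π a))  ≡⟨ insertTopAfter-anchor a (orbit f π s (π a)) ⟨
    insertTopAfter a (a ∷ orbit f π s (π a))                ≡⟨ cong (insertTopAfter a) (orbit-step f π πa≢s) ⟨
    insertTopAfter a (orbit (suc f) π s a)                  ∎
    where
    open ≡-Reasoning
    a∉ : a ∉ orbit f π s (π a)
    a∉ = proj₂ (orbit-unique-tail f πa≢s u)

  orbit-insertAfter : ∀ f {s x} → Reaches f π s x → Unique (orbit f π s x) →
    orbit (suc f) σ (inject₁ s) (inject₁ x) ≡ insertTopAfter a (orbit f π s x)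
  orbit-insertAfter (suc f) {s} {x} r u = byAnchor (x ≟ᶠ a) r
    where
    byAnchor : Dec (x ≡ a) → Reaches (suc f) π s x →
      orbit (suc (suc f)) σ (inject₁ s) (inject₁ x) ≡ insertTopAfter a (orbit (suc f) π s x)
    byAnchor (yes refl) r = orbit-insertAfter-anchor f r u
    byAnchor (no x≢a) (inj₁ πx≡s) = begin
      orbit (suc (suc f)) σ (inject₁ s) (inject₁ x) ≡⟨ orbit-stop (suc f) σ (trans (σ-skip x≢a) (cong inject₁ πx≡s)) ⟩
      inject₁ x ∷ []                                ≡⟨ insertTopAfter-skip a [] x≢a ⟨
      insertTopAfter a (x ∷ [])                     ≡⟨ cong (insertTopAfter a) (orbit-stop f π πx≡s) ⟨
      insertTopAfter a (orbit (suc f) π s x)        ∎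
      where open ≡-Reasoning
    byAnchor (no x≢a) (inj₂ (πx≢s , r)) = begin
      orbit (suc (suc f)) σ (inject₁ s) (inject₁ x)           ≡⟨ orbit-step (suc f) σ (inject₁-≢ (σ-skip x≢a) πx≢s) ⟩
      inject₁ x ∷ orbit (suc f) σ (inject₁ s) (σ (inject₁ x)) ≡⟨ cong (λ y → inject₁ x ∷ orbit (suc f) σ (inject₁ s) y) (σ-skip x≢a) ⟩
      inject₁ x ∷ orbit (suc f) σ (inject₁ s) (inject₁ (π x)) ≡⟨ cong (inject₁ x ∷_) (orbit-insertAfter f r (proj₁ (orbit-unique-tail f πx≢s u))) ⟩
      inject₁ x ∷ insertTopAfter a (orbit f π s (π x))        ≡⟨ insertTopAfter-skip a (orbit f π s (π x)) x≢a ⟨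
      insertTopAfter a (x ∷ orbit f π s (π x))                ≡⟨ cong (insertTopAfter a) (orbit-step f π πx≢s) ⟨
      insertTopAfter a (orbit (suc f) π s x)                  ∎
      where open ≡-Reasoning

  Reaches-insertAfter-anchor : ∀ f {s} → Reaches (suc f) π s a → Unique (orbit (suc f) π s a) →
    Reaches (suc (suc f)) σ (inject₁ s) (inject₁ a)
  Reaches-insertAfter-anchor f {s} r u = inj₂ (σ-anchor≢ , subst (Reaches (suc f) σ (inject₁ s)) (sym σ-anchor) (fromTop r))
    where
    fromTop : Reaches (suc f) π s a → Reaches (suc f) σ (inject₁ s) top
    fromTop (inj₁ πa≡s)        = inj₁ (trans σ-top (cong inject₁ πa≡s))
    fromTop (inj₂ (πa≢s , r′)) = inj₂ (inject₁-≢ σ-top πa≢s , subst (Reaches f σ (inject₁ s)) (sym σ-top)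
      (Reaches-insertAfter-∉ f r′ (proj₂ (orbit-unique-tail f πa≢s u))))

  Reaches-insertAfter : ∀ f {s x} → Reaches f π s x → Unique (orbit f π s x) → Reaches (suc f) σ (inject₁ s) (inject₁ x)
  Reaches-insertAfter (suc f) {s} {x} r u = byAnchor (x ≟ᶠ a) r
    where
    byAnchor : Dec (x ≡ a) → Reaches (suc f) π s x → Reaches (suc (suc f)) σ (inject₁ s) (inject₁ x)
    byAnchor (yes refl) r = Reaches-insertAfter-anchor f r u
    byAnchor (no x≢a) (inj₁ πx≡s) = inj₁ (trans (σ-skip x≢a) (cong inject₁ πx≡s))
    byAnchor (no x≢a) (inj₂ (πx≢s , r)) = inj₂ (inject₁-≢ (σ-skip x≢a) πx≢s ,
      subst (Reaches (suc f) σ (inject₁ s)) (sym (σ-skip x≢a)) (Reaches-insertAfter f r (proj₁ (orbit-unique-tail f πx≢s u))))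

  module _ (π-inj : Injective _≡_ _≡_ π) where

    orbit-insertAfter-toTop : ∀ f y → orbit f σ top (inject₁ y) ≡ map inject₁ (orbit f π (π a) y)
    orbit-insertAfter-toTop zero    y = refl
    orbit-insertAfter-toTop (suc f) y with y ≟ᶠ a
    ... | yes refl = trans (orbit-stop f σ σ-anchor) (sym (cong (map inject₁) (orbit-stop f π refl)))
    ... | no  y≢a  = begin
      orbit (suc f) σ top (inject₁ y)           ≡⟨ orbit-step f σ (inject₁≢top ∘ trans (sym (σ-skip y≢a))) ⟩
      inject₁ y ∷ orbit f σ top (σ (inject₁ y)) ≡⟨ cong (λ z → inject₁ y ∷ orbit f σ top z) (σ-skip y≢a) ⟩
      inject₁ y ∷ orbit f σ top (inject₁ (π y)) ≡⟨ cong (inject₁ y ∷_) (orbit-insertAfter-toTop f (π y)) ⟩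
      map inject₁ (y ∷ orbit f π (π a) (π y))   ≡⟨ cong (map inject₁) (orbit-step f π (y≢a ∘ π-inj)) ⟨
      map inject₁ (orbit (suc f) π (π a) y)     ∎
      where open ≡-Reasoning

    Reaches-insertAfter-toTop : ∀ f {y} → Reaches f π (π a) y → Reaches f σ top (inject₁ y)
    Reaches-insertAfter-toTop (suc f) (inj₁ πy≡πa) with π-inj πy≡πa
    ... | refl = inj₁ σ-anchor
    Reaches-insertAfter-toTop (suc f) {y} (inj₂ (πy≢πa , r)) = inj₂ (inject₁≢top ∘ trans (sym σy≡) ,
      subst (Reaches f σ top) (sym σy≡) (Reaches-insertAfter-toTop f r))
      where σy≡ = σ-skip (πy≢πa ∘ cong π)

    cycleOrbit-insertAfter-top : orbit (suc m) σ top top ≡ top ∷ map inject₁ (orbit m π (π a) (π a))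
    cycleOrbit-insertAfter-top = trans (orbit-step m σ (inject₁≢top ∘ trans (sym σ-top)))
      (cong (top ∷_) (trans (cong (orbit m σ top) σ-top) (orbit-insertAfter-toTop m (π a))))

    Reaches-insertAfter-top : Reaches m π (π a) (π a) → Reaches (suc m) σ top top
    Reaches-insertAfter-top r = inj₂ (inject₁≢top ∘ trans (sym σ-top) , subst (Reaches m σ top) (sym σ-top) (Reaches-insertAfter-toTop m r))

CycleCloses : ∀ {n} → ℕ → (Fin n → Fin n) → Fin n → Set
CycleCloses f π s = Reaches f π s s × Unique (orbit f π s s)

CycleCloses-cong : ∀ {n f} {π σ : Fin n → Fin n} → π ≗ σ → ∀ {s} → CycleCloses f σ s → CycleCloses f π s
CycleCloses-cong {f = f} π≗σ {s} (r , u) = Reaches-cong (sym ∘ π≗σ) f r , subst Unique (sym (orbit-cong π≗σ f s s)) u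

-- Proved along insertTop-cases rather than by a pigeonhole argument.
cycles-close : ∀ m {π : Fin m → Fin m} → Injective _≡_ _≡_ π → ∀ s → CycleCloses m π s
cycles-close zero    _     ()
cycles-close (suc m) {π} π-inj s with insertTop-cases π-inj
... | inj₁ (_ , π≗σ)     = CycleCloses-cong π≗σ (fixedCase (view s))
  where
  ρ : Fin m → Fin m
  ρ = removeTop π
  IH : ∀ s → CycleCloses m ρ s
  IH = cycles-close m (removeTop-injective π-inj)
  fixedCase : ∀ {s} → View s → CycleCloses (suc m) (insertFixed ρ) s
  fixedCase ‵fromℕ       = inj₁ (insertFixed-top ρ) , subst Unique (sym (cycleOrbit-insertFixed-top ρ)) ([] ∷ [])
  fixedCase (‵inject₁ s) with r , u ← IH s = Reaches-suc m (Reaches-insertFixed ρ m r) ,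
    subst Unique (sym (cycleOrbit-insertFixed ρ s r)) (map⁺ inject₁-injective u)
... | inj₂ (a , _ , π≗σ) = CycleCloses-cong π≗σ (afterCase (view s))
  where
  ρ : Fin m → Fin m
  ρ = removeTop π
  ρ-inj : Injective _≡_ _≡_ ρ
  ρ-inj = removeTop-injective π-inj
  IH : ∀ s → CycleCloses m ρ s
  IH = cycles-close m ρ-inj
  afterCase : ∀ {s} → View s → CycleCloses (suc m) (insertAfter a ρ) s
  afterCase ‵fromℕ       with r , u ← IH (ρ a) = Reaches-insertAfter-top a ρ ρ-inj r ,
    subst Unique (sym (cycleOrbit-insertAfter-top a ρ ρ-inj)) (¬Any⇒All¬ _ top∉map-inject₁ ∷ map⁺ inject₁-injective u)
  afterCase (‵inject₁ s) with r , u ← IH s = Reaches-insertAfter a ρ m r u ,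
    subst Unique (sym (orbit-insertAfter a ρ m r u)) (insertTopAfter-unique a u)

module _ {n : ℕ} where

  cycleWord : (Fin n → Fin n) → List (Fin n)
  cycleWord π = concatMap (cycleOf π) (cycleMins π)

  cycleOf-cong : ∀ {π σ : Fin n → Fin n} → π ≗ σ → ∀ s → cycleOf π s ≡ cycleOf σ s
  cycleOf-cong π≗σ s = orbit-cong π≗σ n s s

  cycleMins-cong : ∀ {π σ : Fin n → Fin n} → π ≗ σ → cycleMins π ≡ cycleMins σ
  cycleMins-cong {π} {σ} π≗σ = cong reverse (filter-≐ (isCycleMin? π) (isCycleMin? σ)
    ((λ {s} → subst (All (s ≤ᶠ_)) (cycleOf-cong π≗σ s)) , (λ {s} → subst (All (s ≤ᶠ_)) (sym (cycleOf-cong π≗σ s))))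
    (allFin n))

  cycleWord-cong : ∀ {π σ : Fin n → Fin n} → π ≗ σ → cycleWord π ≡ cycleWord σ
  cycleWord-cong {π} {σ} π≗σ = trans (cong (concatMap (cycleOf π)) (cycleMins-cong π≗σ))
                                     (concatMap-cong (cycleOf-cong π≗σ) (cycleMins σ))

allFin-suc : ∀ m → allFin (suc m) ≡ map inject₁ (allFin m) ++ top ∷ []
allFin-suc m = trans (tabulate-∷ʳ m (λ i → i)) (cong (_++ top ∷ []) (sym (map-tabulate (λ i → i) inject₁)))
  where
  tabulate-∷ʳ : ∀ {A : Set} m (f : Fin (suc m) → A) → List.tabulate f ≡ List.tabulate (f ∘ inject₁) ++ f top ∷ []
  tabulate-∷ʳ zero    f = refl
  tabulate-∷ʳ (suc m) f = cong (f zero ∷_) (tabulate-∷ʳ m (f ∘ suc))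

module _ {A B : Set} {P : Pred A 0ℓ} {Q : Pred B 0ℓ} (P? : Decidable P) (Q? : Decidable Q) (g : B → A) where

  filter-map : (∀ {x} → P (g x) → Q x) → (∀ {x} → Q x → P (g x)) → ∀ xs → filter P? (map g xs) ≡ map g (filter Q? xs)
  filter-map PQ QP []       = refl
  filter-map PQ QP (x ∷ xs) with P? (g x) | Q? x
  ... | yes p | yes _ = cong (g x ∷_) (filter-map PQ QP xs)
  ... | yes p | no ¬q = ⊥-elim (¬q (PQ p))
  ... | no ¬p | yes q = ⊥-elim (¬p (QP q))
  ... | no _  | no _  = filter-map PQ QP xs

module _ {m : ℕ} where

  inject₁-mono-≤ : ∀ {s y : Fin m} → s ≤ᶠ y → inject₁ s ≤ᶠ inject₁ y
  inject₁-mono-≤ {s} {y} = subst₂ _≤_ (sym (toℕ-inject₁ s)) (sym (toℕ-inject₁ y))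

  inject₁-cancel-≤ : ∀ {s y : Fin m} → inject₁ s ≤ᶠ inject₁ y → s ≤ᶠ y
  inject₁-cancel-≤ {s} {y} = subst₂ _≤_ (toℕ-inject₁ s) (toℕ-inject₁ y)

  All-≤-map-inject₁ : ∀ {s l} → All (s ≤ᶠ_) l → All (inject₁ s ≤ᶠ_) (map inject₁ l)
  All-≤-map-inject₁ = All.map⁺ ∘ All.map inject₁-mono-≤

  All-≤-insertTopAfter : ∀ a {s l} → All (s ≤ᶠ_) l → All (inject₁ s ≤ᶠ_) (insertTopAfter a l)
  All-≤-insertTopAfter a {l = l} s≤l = All.tabulate λ z∈ → case (∈-insertTopAfter⁻ a l z∈)
    where
    case : ∀ {z} → _ → inject₁ _ ≤ᶠ z
    case (inj₁ refl)             = ≤fromℕ _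
    case (inj₂ (y , y∈ , refl)) = inject₁-mono-≤ (All.lookup s≤l y∈)

  All-≤-insertTopAfter⁻ : ∀ a {s l} → All (inject₁ s ≤ᶠ_) (insertTopAfter a l) → All (s ≤ᶠ_) l
  All-≤-insertTopAfter⁻ a s≤l = All.tabulate λ y∈ → inject₁-cancel-≤ (All.lookup s≤l (∈-insertTopAfter⁺ a y∈))

  private
    reverse-filter-[_] : ∀ {P : Pred (Fin (suc m)) 0ℓ} (P? : Decidable P) x → reverse (filter P? (x ∷ [])) ≡ filter P? (x ∷ [])
    reverse-filter-[_] P? x with does (P? x)
    ... | true  = refl
    ... | false = refl

  module _ {σ : Fin (suc m) → Fin (suc m)} {π : Fin m → Fin m}
           (min⁻ : ∀ {s} → IsCycleMin σ (inject₁ s) → IsCycleMin π s)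
           (min⁺ : ∀ {s} → IsCycleMin π s → IsCycleMin σ (inject₁ s)) where

    cycleMins-extend : cycleMins σ ≡ filter (isCycleMin? σ) (top ∷ []) ++ map inject₁ (cycleMins π)
    cycleMins-extend = begin
      reverse (filter Pσ (allFin (suc m)))                             ≡⟨ cong (reverse ∘ filter Pσ) (allFin-suc m) ⟩
      reverse (filter Pσ (map inject₁ (allFin m) ++ top ∷ []))         ≡⟨ cong reverse (filter-++ Pσ (map inject₁ (allFin m)) (top ∷ [])) ⟩
      reverse (filter Pσ (map inject₁ (allFin m)) ++ filter Pσ (top ∷ [])) ≡⟨ reverse-++ (filter Pσ (map inject₁ (allFin m))) _ ⟩
      reverse (filter Pσ (top ∷ [])) ++ reverse (filter Pσ (map inject₁ (allFin m)))
        ≡⟨ cong₂ _++_ (reverse-filter-[ Pσ ] top) (cong reverse (filter-map Pσ (isCycleMin? π) inject₁ min⁻ min⁺ (allFin m))) ⟩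
      filter Pσ (top ∷ []) ++ reverse (map inject₁ (filter (isCycleMin? π) (allFin m)))
        ≡⟨ cong (filter Pσ (top ∷ []) ++_) (reverse-map inject₁ (filter (isCycleMin? π) (allFin m))) ⟨
      filter Pσ (top ∷ []) ++ map inject₁ (cycleMins π)                ∎
      where
      open ≡-Reasoning
      Pσ : Decidable (IsCycleMin σ)
      Pσ = isCycleMin? σ

module _ {m : ℕ} {π : Fin m → Fin m} (π-inj : Injective _≡_ _≡_ π) where

  private
    reaches : ∀ s → Reaches m π s s
    reaches s = proj₁ (cycles-close m π-inj s)

    σ : Fin (suc m) → Fin (suc m)
    σ = insertFixed π

  cycleOf-insertFixed : ∀ s → cycleOf σ (inject₁ s) ≡ map inject₁ (cycleOf π s)
  cycleOf-insertFixed s = cycleOrbit-insertFixed π s (reaches s)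

  cycleMins-insertFixed : cycleMins σ ≡ top ∷ map inject₁ (cycleMins π)
  cycleMins-insertFixed = trans (cycleMins-extend min⁻ min⁺) (cong (_++ map inject₁ (cycleMins π)) (filter-accept (isCycleMin? σ) top-min))
    where
    min⁻ : ∀ {s} → IsCycleMin σ (inject₁ s) → IsCycleMin π s
    min⁻ {s} = All.map inject₁-cancel-≤ ∘ All.map⁻ ∘ subst (All (inject₁ s ≤ᶠ_)) (cycleOf-insertFixed s)
    min⁺ : ∀ {s} → IsCycleMin π s → IsCycleMin σ (inject₁ s)
    min⁺ {s} = subst (All (inject₁ s ≤ᶠ_)) (sym (cycleOf-insertFixed s)) ∘ All-≤-map-inject₁
    top-min : IsCycleMin σ top
    top-min = subst (All (top ≤ᶠ_)) (sym (cycleOrbit-insertFixed-top π)) (≤ᶠ-refl ∷ [])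

  cycleWord-insertFixed : cycleWord σ ≡ top ∷ map inject₁ (cycleWord π)
  cycleWord-insertFixed = begin
    concatMap (cycleOf σ) (cycleMins σ)                         ≡⟨ cong (concatMap (cycleOf σ)) cycleMins-insertFixed ⟩
    cycleOf σ top ++ concatMap (cycleOf σ) (map inject₁ (cycleMins π)) ≡⟨ cong₂ _++_ (cycleOrbit-insertFixed-top π) (concatMap-map (cycleOf σ) inject₁ (cycleMins π)) ⟩
    top ∷ concatMap (cycleOf σ ∘ inject₁) (cycleMins π)         ≡⟨ cong (top ∷_) (concatMap-cong cycleOf-insertFixed (cycleMins π)) ⟩
    top ∷ concatMap (map inject₁ ∘ cycleOf π) (cycleMins π)     ≡⟨ cong (top ∷_) (map-concatMap inject₁ (cycleOf π) (cycleMins π)) ⟨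
    top ∷ map inject₁ (cycleWord π)                             ∎
    where open ≡-Reasoning

  module _ (a : Fin m) where

    private
      τ : Fin (suc m) → Fin (suc m)
      τ = insertAfter a π

    cycleOf-insertAfter : ∀ s → cycleOf τ (inject₁ s) ≡ insertTopAfter a (cycleOf π s)
    cycleOf-insertAfter s = orbit-insertAfter a π m (reaches s) (proj₂ (cycles-close m π-inj s))

    cycleMins-insertAfter : cycleMins τ ≡ map inject₁ (cycleMins π)
    cycleMins-insertAfter = trans (cycleMins-extend min⁻ min⁺) (cong (_++ map inject₁ (cycleMins π)) (filter-reject (isCycleMin? τ) top-not-min))
      where
      min⁻ : ∀ {s} → IsCycleMin τ (inject₁ s) → IsCycleMin π s
      min⁻ {s} = All-≤-insertTopAfter⁻ a ∘ subst (All (inject₁ s ≤ᶠ_)) (cycleOf-insertAfter s)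
      min⁺ : ∀ {s} → IsCycleMin π s → IsCycleMin τ (inject₁ s)
      min⁺ {s} = subst (All (inject₁ s ≤ᶠ_)) (sym (cycleOf-insertAfter s)) ∘ All-≤-insertTopAfter a
      -- The cycle of top also contains inject₁ (π a) < top.
      top-not-min : ¬ IsCycleMin τ top
      top-not-min top-min = <⇒≱ (inject₁<top (π a)) (All.lookup top≤ πa∈)
        where
        top≤ : All (top ≤ᶠ_) (top ∷ map inject₁ (orbit m π (π a) (π a)))
        top≤ = subst (All (top ≤ᶠ_)) (cycleOrbit-insertAfter-top a π π-inj) top-min
        πa∈ : inject₁ (π a) ∈ top ∷ map inject₁ (orbit m π (π a) (π a))
        πa∈ = there (∈-map⁺ inject₁ (start∈orbit π (π a) (π a) {{nonZeroIndex a}}))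

    cycleWord-insertAfter : cycleWord τ ≡ insertTopAfter a (cycleWord π)
    cycleWord-insertAfter = begin
      concatMap (cycleOf τ) (cycleMins τ)                          ≡⟨ cong (concatMap (cycleOf τ)) cycleMins-insertAfter ⟩
      concatMap (cycleOf τ) (map inject₁ (cycleMins π))            ≡⟨ concatMap-map (cycleOf τ) inject₁ (cycleMins π) ⟩
      concatMap (cycleOf τ ∘ inject₁) (cycleMins π)                ≡⟨ concatMap-cong cycleOf-insertAfter (cycleMins π) ⟩
      concatMap (insertTopAfter a ∘ cycleOf π) (cycleMins π)       ≡⟨ insertTopAfter-concatMap a (cycleOf π) (cycleMins π) ⟨
      insertTopAfter a (cycleWord π)                               ∎
      where open ≡-Reasoning

module _ {A : Set} where

  lastOr : A → List A → A
  lastOr d []      = d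
  lastOr d (x ∷ l) = lastOr x l

  lastOr-++-∷ : ∀ d xs y ys → lastOr d (xs ++ y ∷ ys) ≡ lastOr y ys
  lastOr-++-∷ d []       y ys = refl
  lastOr-++-∷ d (x ∷ xs) y ys = lastOr-++-∷ x xs y ys

  lastOr-∈ : ∀ d x xs → lastOr d (x ∷ xs) ∈ x ∷ xs
  lastOr-∈ d x []        = here refl
  lastOr-∈ d x (x′ ∷ xs) = there (lastOr-∈ x x′ xs)

  Unique-middle : ∀ {a : A} (U V : List A) → Unique (U ++ a ∷ V) → a ∉ U × a ∉ V
  Unique-middle []      V (a∉V ∷ _) = (λ ()) , λ a∈ → All.lookup a∉V a∈ refl
  Unique-middle (u ∷ U) V (u∉ ∷ uU) with IH ← Unique-middle U V uU =
    (λ { (here a≡u) → All.lookup u∉ (∈-++⁺ʳ U (here refl)) (sym a≡u) ; (there a∈) → proj₁ IH a∈ }) , proj₂ IH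

suc-+≤*-suc : ∀ p q → suc (p + q) ≤ suc p * suc q
suc-+≤*-suc p q = s≤s (subst (_≤ q + p * suc q) (+-comm q p) (+-monoʳ-≤ q (m≤m*n p (suc q))))

module _ {m : ℕ} where

  inject₁-<-reflects : ∀ (a b : Fin m) → does (inject₁ a <ᶠ? inject₁ b) ≡ does (a <ᶠ? b)
  inject₁-<-reflects a b rewrite toℕ-inject₁ a | toℕ-inject₁ b = refl

  occ121'-map-inject₁ : ∀ (l : List (Fin m)) → occ121' (map inject₁ l) ≡ occ121' l
  occ121'-map-inject₁ = occ121'-map inject₁ inject₁-<-reflects

  -- Inserting top right after the last letter creates no occurrence; inserting it anywhere
  -- else makes it the middle letter of at least length W - 1 occurrences.
  InsertionOutcome : Fin m → Fin m → List (Fin m) → Set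
  InsertionOutcome d a W =
    (lastOr d W ≡ a × occ121' (insertTopAfter a W) ≡ occ121' W)
    ⊎ (lastOr d W ≢ a × 1 ≤ occ121' (insertTopAfter a W) × length W ≤ suc (occ121' (insertTopAfter a W)))

  occ121'-insertTopAfter-split : ∀ d a U V → a ∉ U → a ∉ V → InsertionOutcome d a (U ++ a ∷ V)
  occ121'-insertTopAfter-split d a U []       a∉U a∉V = inj₁ (lastOr-++-∷ d U a [] , (begin
    occ121' (insertTopAfter a (U ++ a ∷ []))         ≡⟨ cong occ121' (insertTopAfter-split a U [] a∉U a∉V) ⟩
    occ121' (map inject₁ (U ++ a ∷ []) ++ top ∷ [])  ≡⟨ occ121'-∷ʳ-max (map-inject₁<top (U ++ a ∷ [])) ⟩
    occ121' (map inject₁ (U ++ a ∷ []))              ≡⟨ occ121'-map-inject₁ (U ++ a ∷ []) ⟩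
    occ121' (U ++ a ∷ [])                            ∎))
    where open ≡-Reasoning
  occ121'-insertTopAfter-split d a U (v ∷ V′) a∉U a∉V =
    inj₂ (last≢a , ≤-trans (s≤s z≤n) many , ≤-trans (≤-reflexive length-W) (s≤s (≤-trans (suc-+≤*-suc p q) many)))
    where
    p : ℕ
    p = length U
    q : ℕ
    q = length V′
    last≢a : lastOr d (U ++ a ∷ v ∷ V′) ≢ a
    last≢a e = a∉V (subst (_∈ v ∷ V′) (trans (sym (lastOr-++-∷ d U a (v ∷ V′))) e) (lastOr-∈ a v V′))
    length-W : length (U ++ a ∷ v ∷ V′) ≡ suc (suc (p + q))
    length-W = trans (length-++ U) (trans (+-suc p (suc q)) (cong suc (+-suc p q)))
    many : suc p * suc q ≤ occ121' (insertTopAfter a (U ++ a ∷ v ∷ V′))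
    many = subst₂ _≤_ (cong₂ _*_ (trans (length-map inject₁ (U ++ a ∷ [])) (trans (length-++ U) (+-comm p 1))) (length-map inject₁ (v ∷ V′)))
      (cong occ121' (sym (insertTopAfter-split a U (v ∷ V′) a∉U a∉V)))
      (occ121'-max-middle (map-inject₁<top (U ++ a ∷ [])) (map-inject₁<top (v ∷ V′)))

  occ121'-insertTopAfter : ∀ d a W → Unique W → a ∈ W → InsertionOutcome d a W
  occ121'-insertTopAfter d a W uW a∈ with U , V , refl ← ∈-∃++ a∈ =
    occ121'-insertTopAfter-split d a U V (proj₁ (Unique-middle {a = a} U V uW)) (proj₂ (Unique-middle {a = a} U V uW))

cycleWord-unique×complete : ∀ m {π : Fin m → Fin m} → Injective _≡_ _≡_ π →
  Unique (cycleWord π) × (∀ x → x ∈ cycleWord π)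
cycleWord-unique×complete zero    _ = [] , λ ()
cycleWord-unique×complete (suc m) {π} π-inj with insertTop-cases π-inj
... | inj₁ (_ , π≗σ) = subst (λ w → Unique w × (∀ x → x ∈ w)) (sym (trans (cycleWord-cong π≗σ) (cycleWord-insertFixed ρ-inj)))
      (¬Any⇒All¬ _ top∉map-inject₁ ∷ map⁺ inject₁-injective (proj₁ IH) , λ x → complete (view x))
  where
  ρ-inj : Injective _≡_ _≡_ (removeTop π)
  ρ-inj = removeTop-injective π-inj
  IH : Unique (cycleWord (removeTop π)) × (∀ x → x ∈ cycleWord (removeTop π))
  IH = cycleWord-unique×complete m ρ-inj
  complete : ∀ {x} → View x → x ∈ top ∷ map inject₁ (cycleWord (removeTop π))
  complete ‵fromℕ       = here refl
  complete (‵inject₁ y) = there (∈-map⁺ inject₁ (proj₂ IH y))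
... | inj₂ (a , _ , π≗σ) = subst (λ w → Unique w × (∀ x → x ∈ w)) (sym (trans (cycleWord-cong π≗σ) (cycleWord-insertAfter ρ-inj a)))
      (insertTopAfter-unique a (proj₁ IH) , λ x → complete (view x))
  where
  ρ-inj : Injective _≡_ _≡_ (removeTop π)
  ρ-inj = removeTop-injective π-inj
  IH : Unique (cycleWord (removeTop π)) × (∀ x → x ∈ cycleWord (removeTop π))
  IH = cycleWord-unique×complete m ρ-inj
  complete : ∀ {x} → View x → x ∈ insertTopAfter a (cycleWord (removeTop π))
  complete ‵fromℕ       = top∈insertTopAfter a (proj₂ IH a)
  complete (‵inject₁ y) = ∈-insertTopAfter⁺ a (proj₂ IH y)

length-cycleWord : ∀ m {π : Fin m → Fin m} → Injective _≡_ _≡_ π → length (cycleWord π) ≡ m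
length-cycleWord m {π} π-inj = ≤-antisym
  (subst (length (cycleWord π) ≤_) (length-tabulate (λ i → i))
    (length-≤-injection (λ x → x) (cycleWord π) (allFin m) unique (λ {x} _ → ∈-allFin x) (λ _ _ e → e)))
  (subst (_≤ length (cycleWord π)) (length-tabulate (λ i → i))
    (length-≤-injection (λ x → x) (allFin m) (cycleWord π) (allFin⁺ m) (λ {x} _ → complete x) (λ _ _ e → e)))
  where
  unique : Unique (cycleWord π)
  unique = proj₁ (cycleWord-unique×complete m π-inj)
  complete : ∀ x → x ∈ cycleWord π
  complete = proj₂ (cycleWord-unique×complete m π-inj)

module _ {A : Set} where

  Unique⇒lookup-injective : ∀ {l} (v : Vec A l) → Unique (toList v) → Injective _≡_ _≡_ (lookup v)
  Unique⇒lookup-injective (x ∷ v) (x∉ ∷ _)  {zero}  {zero}  _ = refl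
  Unique⇒lookup-injective (x ∷ v) (x∉ ∷ _)  {zero}  {suc j} e = ⊥-elim (All.lookup x∉ (∈-toList⁺ (∈-lookup j v)) e)
  Unique⇒lookup-injective (x ∷ v) (x∉ ∷ _)  {suc i} {zero}  e = ⊥-elim (All.lookup x∉ (∈-toList⁺ (∈-lookup i v)) (sym e))
  Unique⇒lookup-injective (x ∷ v) (_  ∷ uv) {suc i} {suc j} e = cong suc (Unique⇒lookup-injective v uv e)

  toList-tabulate : ∀ {l} (f : Fin l → A) → toList (tabulate f) ≡ List.tabulate f
  toList-tabulate {zero}  f = refl
  toList-tabulate {suc l} f = cong (f zero ∷_) (toList-tabulate (f ∘ suc))

  tabulate-≗ : ∀ {l} (v : Vec A l) {f} → f ≗ lookup v → tabulate f ≡ v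
  tabulate-≗ v f≗v = trans (tabulate-cong f≗v) (tabulate∘lookup v)

module _ {n : ℕ} where

  IsPerm⇒injective : (v : Vec (Fin n) n) → IsPerm v → Injective _≡_ _≡_ (lookup v)
  IsPerm⇒injective = Unique⇒lookup-injective

  injective⇒IsPerm : (π : Fin n → Fin n) → Injective _≡_ _≡_ π → IsPerm (tabulate π)
  injective⇒IsPerm π π-inj = subst Unique (sym (toList-tabulate π)) (tabulate⁺ π-inj)

module _ {m : ℕ} (w : Vec (Fin m) m) (pw : IsPerm w) (v : Vec (Fin (suc m)) (suc m)) where

  private
    π : Fin m → Fin m
    π = lookup w
    π-inj : Injective _≡_ _≡_ π
    π-inj = IsPerm⇒injective w pw

    cyclicOcc≡occ121' : ∀ {σ} → lookup v ≗ σ → cyclicOcc121' v ≡ occ121' (cycleWord σ)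
    cyclicOcc≡occ121' {σ} v≗σ = trans (cong numOcc121' (cycleWord-cong v≗σ)) (numOcc121'≡occ121' (cycleWord σ))

  module _ (v≗σ : lookup v ≗ insertFixed π) where

    numCycles-insertFixed : numCycles v ≡ suc (numCycles w)
    numCycles-insertFixed = begin
      length (cycleMins (lookup v))            ≡⟨ cong length (trans (cycleMins-cong v≗σ) (cycleMins-insertFixed π-inj)) ⟩
      length (top ∷ map inject₁ (cycleMins π)) ≡⟨ cong suc (length-map inject₁ (cycleMins π)) ⟩
      suc (numCycles w)                        ∎
      where open ≡-Reasoning

    cyclicOcc121'-insertFixed : cyclicOcc121' v ≡ cyclicOcc121' w
    cyclicOcc121'-insertFixed = begin
      cyclicOcc121' v                            ≡⟨ cyclicOcc≡occ121' v≗σ ⟩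
      occ121' (cycleWord (insertFixed π))        ≡⟨ cong occ121' (cycleWord-insertFixed π-inj) ⟩
      occ121' (top ∷ map inject₁ (Ψ w))          ≡⟨ occ121'-max-∷ (map-inject₁<top (Ψ w)) ⟩
      occ121' (map inject₁ (Ψ w))                ≡⟨ occ121'-map-inject₁ (Ψ w) ⟩
      occ121' (Ψ w)                              ≡⟨ numOcc121'≡occ121' (Ψ w) ⟨
      cyclicOcc121' w                            ∎
      where open ≡-Reasoning

  module _ (a : Fin m) (v≗σ : lookup v ≗ insertAfter a π) where

    numCycles-insertAfter : numCycles v ≡ numCycles w
    numCycles-insertAfter = trans (cong length (trans (cycleMins-cong v≗σ) (cycleMins-insertAfter π-inj a)))
                                  (length-map inject₁ (cycleMins π))

    private
      occ-v : cyclicOcc121' v ≡ occ121' (insertTopAfter a (Ψ w))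
      occ-v = trans (cyclicOcc≡occ121' v≗σ) (cong occ121' (cycleWord-insertAfter π-inj a))

    cyclicOcc121'-insertAfter : ∀ d →
      (lastOr d (Ψ w) ≡ a × cyclicOcc121' v ≡ cyclicOcc121' w)
      ⊎ (lastOr d (Ψ w) ≢ a × 1 ≤ cyclicOcc121' v × m ≤ suc (cyclicOcc121' v))
    cyclicOcc121'-insertAfter d = Sum.map
      (λ (last≡a , same) → last≡a , trans occ-v (trans same (sym (numOcc121'≡occ121' (Ψ w)))))
      (λ (last≢a , one≤ , length≤) → last≢a , subst (1 ≤_) (sym occ-v) one≤ ,
         subst₂ (λ l o → l ≤ suc o) (length-cycleWord m π-inj) (sym occ-v) length≤)
      (occ121'-insertTopAfter d a (Ψ w) (proj₁ word-perm) (proj₂ word-perm a))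
      where
      word-perm : Unique (Ψ w) × (∀ x → x ∈ Ψ w)
      word-perm = cycleWord-unique×complete m π-inj

small⇒¬many : ∀ {k n} → k ≡ 0 ⊎ k + 2 ≤ n → 1 ≤ k → n ≤ suc k → ⊥
small⇒¬many (inj₁ refl)  ()
small⇒¬many {k} {n} (inj₂ k+2≤n) _ n≤1+k = <-irrefl refl (≤-trans (subst (_≤ n) (+-comm k 2) k+2≤n) n≤1+k)

CountedWithNewCycle : (k j n : ℕ) → Vec (Fin n) n → Set
CountedWithNewCycle k j n w = IsPerm w × suc (numCycles w) ≡ j × cyclicOcc121' w ≡ k

countedWithNewCycle? : ∀ k j n (w : Vec (Fin n) n) → Dec (CountedWithNewCycle k j n w)
countedWithNewCycle? k j n w = isPerm? w ×-dec ((suc (numCycles w) ≟ j) ×-dec (cyclicOcc121' w ≟ k))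

module Insertion (k j m : ℕ) (k-small : k ≡ 0 ⊎ k + 2 ≤ suc m) where

  private
    n : ℕ
    n = suc m
    Big : Set
    Big = Vec (Fin (suc n)) (suc n)
    Small : Set
    Small = Vec (Fin n) n

    Target : Small ⊎ Small → Set
    Target = CountedWithNewCycle k j n ⟨⊎⟩ Counted k j n

    removed : Big → Small
    removed v = tabulate (removeTop (lookup v))

    lookup-removed : ∀ v → lookup (removed v) ≗ removeTop (lookup v)
    lookup-removed v = lookup∘tabulate (removeTop (lookup v))

    removed-IsPerm : ∀ v → IsPerm v → IsPerm (removed v)
    removed-IsPerm v pv = injective⇒IsPerm _ (removeTop-injective (IsPerm⇒injective v pv))

    anchor : Small → Fin n
    anchor w = lastOr zero (Ψ w)

  split : Big → Small ⊎ Small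
  split v = if does (lookup v top ≟ᶠ top) then inj₁ (removed v) else inj₂ (removed v)

  merge : Small ⊎ Small → Big
  merge (inj₁ w) = tabulate (insertFixed (lookup w))
  merge (inj₂ w) = tabulate (insertAfter (anchor w) (lookup w))

  private
    split-fixed : ∀ v → lookup v top ≡ top → split v ≡ inj₁ (removed v)
    split-fixed v fixed rewrite dec-true (lookup v top ≟ᶠ top) fixed = refl

    split-moved : ∀ v → lookup v top ≢ top → split v ≡ inj₂ (removed v)
    split-moved v moved rewrite dec-false (lookup v top ≟ᶠ top) moved = refl

    module Removed (v : Big) (pv : IsPerm v) where
      w : Small
      w = removed v
      pw : IsPerm w
      pw = removed-IsPerm v pv
      w-inj : Injective _≡_ _≡_ (lookup w)
      w-inj = IsPerm⇒injective w pw

      fixed-view : lookup v ≗ insertFixed (removeTop (lookup v)) → lookup v ≗ insertFixed (lookup w)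
      fixed-view v≗ x = trans (v≗ x) (insertFixed-cong (sym ∘ lookup-removed v) x)

      moved-view : ∀ a → lookup v ≗ insertAfter a (removeTop (lookup v)) → lookup v ≗ insertAfter a (lookup w)
      moved-view a v≗ x = trans (v≗ x) (insertAfter-cong a (sym ∘ lookup-removed v) x)

  split-counted : ∀ v → Counted k j (suc n) v → Target (split v) × merge (split v) ≡ v
  split-counted v (pv , cycles , occs) = [ fixedCase , movedCase ]′ (insertTop-cases (IsPerm⇒injective v pv))
    where
    open Removed v pv
    Goal : Small ⊎ Small → Set
    Goal b = Target b × merge b ≡ v

    fixedCase : lookup v top ≡ top × lookup v ≗ insertFixed (removeTop (lookup v)) → Goal (split v)
    fixedCase (fixed , v≗) = subst Goal (sym (split-fixed v fixed))
      ((pw , trans (sym (numCycles-insertFixed w pw v v≗σ)) cycles , trans (sym (cyclicOcc121'-insertFixed w pw v v≗σ)) occs) ,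
       tabulate-≗ v (sym ∘ v≗σ))
      where
      v≗σ : lookup v ≗ insertFixed (lookup w)
      v≗σ = fixed-view v≗

    movedCase : ∃ (λ a → lookup v top ≢ top × lookup v ≗ insertAfter a (removeTop (lookup v))) → Goal (split v)
    movedCase (a , moved , v≗) = [ anchored , (λ (_ , 1≤occ , n≤1+occ) → ⊥-elim (small⇒¬many k-small
        (subst (1 ≤_) occs 1≤occ) (subst (λ o → n ≤ suc o) occs n≤1+occ))) ]′
      (cyclicOcc121'-insertAfter w pw v a v≗σ zero)
      where
      v≗σ : lookup v ≗ insertAfter a (lookup w)
      v≗σ = moved-view a v≗
      anchored : anchor w ≡ a × cyclicOcc121' v ≡ cyclicOcc121' w → Goal (split v)
      anchored (anchor≡a , same) = subst Goal (sym (split-moved v moved))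
        ((pw , trans (sym (numCycles-insertAfter w pw v a v≗σ)) cycles , trans (sym same) occs) ,
         tabulate-≗ v (λ x → trans (cong (λ b → insertAfter b (lookup w) x) anchor≡a) (sym (v≗σ x))))

  merge-target : ∀ b → Target b → Counted k j (suc n) (merge b) × split (merge b) ≡ b
  merge-target (inj₁ w) (pw , cycles , occs) =
    (pv , trans (numCycles-insertFixed w pw v v≗σ) cycles , trans (cyclicOcc121'-insertFixed w pw v v≗σ) occs) ,
    trans (split-fixed v (trans (v≗σ top) (insertFixed-top (lookup w))))
          (cong inj₁ (tabulate-≗ w (λ y → trans (removeTop-cong v≗σ y) (removeTop-insertFixed (lookup w) y))))
    where
    v : Big
    v = merge (inj₁ w)
    v≗σ : lookup v ≗ insertFixed (lookup w)
    v≗σ = lookup∘tabulate (insertFixed (lookup w))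
    pv : IsPerm v
    pv = injective⇒IsPerm _ (insertFixed-injective (IsPerm⇒injective w pw))
  merge-target (inj₂ w) (pw , cycles , occs) = [ anchored , (λ (anchor≢anchor , _) → ⊥-elim (anchor≢anchor refl)) ]′
    (cyclicOcc121'-insertAfter w pw v (anchor w) v≗σ zero)
    where
    v : Big
    v = merge (inj₂ w)
    v≗σ : lookup v ≗ insertAfter (anchor w) (lookup w)
    v≗σ = lookup∘tabulate (insertAfter (anchor w) (lookup w))
    pv : IsPerm v
    pv = injective⇒IsPerm _ (insertAfter-injective (anchor w) (IsPerm⇒injective w pw))
    anchored : anchor w ≡ anchor w × cyclicOcc121' v ≡ cyclicOcc121' w → Counted k j (suc n) v × split v ≡ inj₂ w
    anchored (_ , same) =
      (pv , trans (numCycles-insertAfter w pw v (anchor w) v≗σ) cycles , trans same occs) ,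
      trans (split-moved v (λ e → inject₁≢top (trans (sym (trans (v≗σ top) (insertAfter-top (anchor w) (lookup w)))) e)))
            (cong inj₂ (tabulate-≗ w (λ y → trans (removeTop-cong v≗σ y) (removeTop-insertAfter (anchor w) (lookup w) y))))

  -- For small k, merge inverts split: a counted permutation whose largest point is not fixed has it
  -- right after the last letter of Ψ, the only insertion place that creates no occurrence.
  f121'-insertion : f121' k j (suc n) ≡ length (filter (countedWithNewCycle? k j n) (allVecs n n)) + f121' k j n
  f121'-insertion = trans
    (length-filter-bijection (counted? k j (suc n)) (countedWithNewCycle? k j n ⊎? counted? k j n)
      (allVecs (suc n) (suc n)) (enum⊎ (allVecs n n) (allVecs n n))
      (allVecs-unique (suc n) (suc n)) (enum⊎-unique (allVecs-unique n n) (allVecs-unique n n))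
      (allVecs-complete (suc n) (suc n)) (enum⊎-complete (allVecs-complete n n) (allVecs-complete n n))
      split merge
      (λ {v} c → proj₁ (split-counted v c)) (λ {b} t → proj₁ (merge-target b t))
      (λ {v} c → proj₂ (split-counted v c)) (λ {b} t → proj₂ (merge-target b t)))
    (length-filter-enum⊎ (countedWithNewCycle? k j n) (counted? k j n) (allVecs n n) (allVecs n n))

numCycles≤ : ∀ n (v : Vec (Fin n) n) → numCycles v ≤ n
numCycles≤ n v = subst₂ _≤_ (sym (length-reverse (filter (isCycleMin? (lookup v)) (allFin n)))) (length-tabulate (λ i → i))
  (length-filter (isCycleMin? (lookup v)) (allFin n))

f121'-too-many-cycles : ∀ k j n → n < j → f121' k j n ≡ 0
f121'-too-many-cycles k j n n<j = cong length (filter-none (counted? k j n)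
  (universal (λ v (_ , cycles , _) → <⇒≱ n<j (subst (_≤ n) cycles (numCycles≤ n v))) (allVecs n n)))

PascalStep : (ℕ → ℕ → ℕ) → ℕ → Set
PascalStep F n = F 0 (suc n) ≡ F 0 n × (∀ j → F (suc j) (suc n) ≡ F j n + F (suc j) n)

f121'-pascalStep : ∀ k n → 1 ≤ n → k ≡ 0 ⊎ k + 2 ≤ n → PascalStep (f121' k) n
f121'-pascalStep k (suc m) _ k-small = zeroCycles , λ j → trans (Insertion.f121'-insertion k (suc j) m k-small)
    (cong (_+ f121' k (suc j) (suc m)) (cong length (filter-≐ (countedWithNewCycle? k (suc j) (suc m)) (counted? k j (suc m))
      ((λ (p , c , o) → p , suc-injective c , o) , (λ (p , c , o) → p , cong suc c , o)) (allVecs (suc m) (suc m)))))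
  where
  zeroCycles : f121' k 0 (suc (suc m)) ≡ f121' k 0 (suc m)
  zeroCycles = trans (Insertion.f121'-insertion k 0 m k-small)
    (cong (λ c → length c + f121' k 0 (suc m)) (filter-none (countedWithNewCycle? k 0 (suc m))
      (universal (λ _ (_ , c , _) → 1+n≢0 c) (allVecs (suc m) (suc m)))))

shiftedBinomial : ℕ → ℕ → ℕ
shiftedBinomial b zero    = 0
shiftedBinomial b (suc j) = b C j

shiftedBinomial-pascal : ∀ b j → shiftedBinomial b j + shiftedBinomial b (suc j) ≡ shiftedBinomial (suc b) (suc j)
shiftedBinomial-pascal b zero    = refl
shiftedBinomial-pascal b (suc j) = nCk+nC[k+1]≡[n+1]C[k+1] b j

pascal-solution : ∀ (F : ℕ → ℕ → ℕ) n₀ b c → (∀ n → n₀ ≤ n → PascalStep F n) →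
  (∀ j → F j n₀ ≡ c * shiftedBinomial b j) → ∀ t j → F j (n₀ + t) ≡ c * shiftedBinomial (b + t) j
pascal-solution F n₀ b c step base zero j = subst₂ (λ n b′ → F j n ≡ c * shiftedBinomial b′ j)
  (sym (+-identityʳ n₀)) (sym (+-identityʳ b)) (base j)
pascal-solution F n₀ b c step base (suc t) j = subst₂ (λ n b′ → F j n ≡ c * shiftedBinomial b′ j)
  (sym (+-suc n₀ t)) (sym (+-suc b t)) (next j)
  where
  IH : ∀ j → F j (n₀ + t) ≡ c * shiftedBinomial (b + t) j
  IH = pascal-solution F n₀ b c step base t
  stepₜ : PascalStep F (n₀ + t)
  stepₜ = step (n₀ + t) (m≤m+n n₀ t)
  next : ∀ j → F j (suc (n₀ + t)) ≡ c * shiftedBinomial (suc (b + t)) j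
  next zero    = trans (proj₁ stepₜ) (IH zero)
  next (suc j) = begin
    F (suc j) (suc (n₀ + t))                                          ≡⟨ proj₂ stepₜ j ⟩
    F j (n₀ + t) + F (suc j) (n₀ + t)                                 ≡⟨ cong₂ _+_ (IH j) (IH (suc j)) ⟩
    c * shiftedBinomial (b + t) j + c * shiftedBinomial (b + t) (suc j) ≡⟨ *-distribˡ-+ c _ _ ⟨
    c * (shiftedBinomial (b + t) j + shiftedBinomial (b + t) (suc j))   ≡⟨ cong (c *_) (shiftedBinomial-pascal (b + t) j) ⟩
    c * shiftedBinomial (suc (b + t)) (suc j)                         ∎
    where open ≡-Reasoning

f121'-0-base : ∀ j → f121' 0 j 1 ≡ 1 * shiftedBinomial 0 j
f121'-0-base 0             = refl
f121'-0-base 1             = refl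
f121'-0-base (suc (suc j)) = f121'-too-many-cycles 0 (2 + j) 1 (s≤s (s≤s z≤n))

f121'-1-base : ∀ j → f121' 1 j 3 ≡ 1 * shiftedBinomial 1 j
f121'-1-base 0 = refl
f121'-1-base 1 = refl
f121'-1-base 2 = refl
f121'-1-base 3 = refl
f121'-1-base (suc (suc (suc (suc j)))) = f121'-too-many-cycles 1 (4 + j) 3 (s≤s (s≤s (s≤s (s≤s z≤n))))

f121'-2-base : ∀ j → f121' 2 j 4 ≡ 2 * shiftedBinomial 2 j
f121'-2-base 0 = refl
f121'-2-base 1 = refl
f121'-2-base 2 = refl
f121'-2-base 3 = refl
f121'-2-base 4 = refl
f121'-2-base (suc (suc (suc (suc (suc j))))) = f121'-too-many-cycles 2 (5 + j) 4 (s≤s (s≤s (s≤s (s≤s (s≤s z≤n)))))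

f121'-0 : ∀ t j → f121' 0 j (1 + t) ≡ 1 * shiftedBinomial t j
f121'-0 = pascal-solution (f121' 0) 1 0 1 (λ n 1≤n → f121'-pascalStep 0 n 1≤n (inj₁ refl)) f121'-0-base

f121'-1 : ∀ t j → f121' 1 j (3 + t) ≡ 1 * shiftedBinomial (1 + t) j
f121'-1 = pascal-solution (f121' 1) 3 1 1 (λ n 3≤n → f121'-pascalStep 1 n (≤-trans (s≤s z≤n) 3≤n) (inj₂ 3≤n)) f121'-1-base

f121'-2 : ∀ t j → f121' 2 j (4 + t) ≡ 2 * shiftedBinomial (2 + t) j
f121'-2 = pascal-solution (f121' 2) 4 2 2 (λ n 4≤n → f121'-pascalStep 2 n (≤-trans (s≤s z≤n) 4≤n) (inj₂ 4≤n)) f121'-2-base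

mainTheorem19 : (∀ m n → 1 ≤ n → 1 ≤ m → m ≤ n → f121' 0 m n ≡ (n ∸ 1) C (m ∸ 1))
    × (∀ m n → 3 ≤ n → 1 ≤ m → m ≤ n ∸ 1 → f121' 1 m n ≡ (n ∸ 2) C (m ∸ 1))
    × (∀ m n → 4 ≤ n → 1 ≤ m → m ≤ n ∸ 1 → f121' 2 m n ≡ 2 * ((n ∸ 2) C (m ∸ 1)))
mainTheorem19 = part-i , part-ii , part-iii
  where
  part-i : ∀ m n → 1 ≤ n → 1 ≤ m → m ≤ n → f121' 0 m n ≡ (n ∸ 1) C (m ∸ 1)
  part-i (suc m) n 1≤n _ _ with t , refl ← m≤n⇒∃[o]m+o≡n 1≤n = trans (f121'-0 t (suc m)) (*-identityˡ _)

  part-ii : ∀ m n → 3 ≤ n → 1 ≤ m → m ≤ n ∸ 1 → f121' 1 m n ≡ (n ∸ 2) C (m ∸ 1)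
  part-ii (suc m) n 3≤n _ _ with t , refl ← m≤n⇒∃[o]m+o≡n 3≤n = trans (f121'-1 t (suc m)) (*-identityˡ _)

  part-iii : ∀ m n → 4 ≤ n → 1 ≤ m → m ≤ n ∸ 1 → f121' 2 m n ≡ 2 * ((n ∸ 2) C (m ∸ 1))
  part-iii (suc m) n 4≤n _ _ with t , refl ← m≤n⇒∃[o]m+o≡n 4≤n = f121'-2 t (suc m)
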